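{- Let $f(n)=\sum_{k=0}^n\binom nk^{ -1}$ for $n\in\mathbb{N}$. For every prime $p$, $\bar f(-1)$ is $p$-definable. Moreover, if $p=2$ then $\bar f(-1)=0$, while if $p$ is odd then $\bar f(-1)\in\mathbb{Z}_p$ and $\bar f(-1)\equiv1\pmod p$.
   Context: For $x=\sum_{i\ge0}\varepsilon_ip^i\in\mathbb{Z}_p$ with $\varepsilon_i\in\{0,\dots,p-1\}$, let $x_n=\sum_{i=0}^n\varepsilon_ip^i\in\mathbb{N}$. One says $\bar f(x)$ is $p$-definable if $\lim_{n\to\infty}f(x_n)$ exists in $\mathbb{Q}_p$ (with respect to the $p$-adic topology), and then $\bar f(x)$ denotes this limit. Here $-1\in\mathbb{Z}_p$ has all digits equal to $p-1$, so $x_n=p^{n+1}-1$. -}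

module Defs where

open import Data.Nat as ℕ using (ℕ; zero; suc; _∸_; _^_; _≥_)
open import Data.Nat.Divisibility using (_∣_)
open import Data.Nat.Combinatorics using (_C_)
open import Data.Integer as ℤ using (ℤ; +_; ∣_∣)
open import Data.Rational using (ℚ; ↥_; ↧ₙ_; _/_; _-_; 0ℚ; 1ℚ; _+_)
open import Data.List using (List; upTo; map; foldr)
open import Data.Product using (Σ; ∃; _×_)
open import Relation.Nullary using (¬_)

-- reciprocal of a natural number as a rational (1/0 := 0; never used,
-- since binomial coefficients n C k with k ≤ n are positive)
recipℕ : ℕ → ℚ
recipℕ zero = 0ℚ
recipℕ (suc m) = (+ 1) / suc m

f : ℕ → ℚ
f n = foldr _+_ 0ℚ (map (λ k → recipℕ (n C k)) (upTo (suc n)))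

-- v_p(q) ≥ k, for k ∈ ℕ (q in lowest terms: p^k ∣ numerator, p ∤ denominator;
-- q = 0 satisfies it for all k)
ValGe : ℕ → ℕ → ℚ → Set
ValGe p k q = (p ^ k ∣ ∣ ↥ q ∣) × ¬ (p ∣ ↧ₙ q)

-- p-adic Cauchy sequence of rationals (⇔ the limit exists in ℚ_p)
PCauchy : ℕ → (ℕ → ℚ) → Set
PCauchy p a = ∀ k → ∃ λ N → ∀ m n → m ≥ N → n ≥ N → ValGe p k (a m - a n)

PConvergesTo : ℕ → (ℕ → ℚ) → ℚ → Set
PConvergesTo p a b = ∀ k → ∃ λ N → ∀ n → n ≥ N → ValGe p k (a n - b)

-- the p-adic limit lies in 1 + pℤ_p (i.e. in ℤ_p and ≡ 1 mod p):
-- since 1 + pℤ_p is open and closed, this is: eventually v_p(a_n - 1) ≥ 1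
LimitIn1+pZp : ℕ → (ℕ → ℚ) → Set
LimitIn1+pZp p a = ∃ λ N → ∀ n → n ≥ N → ValGe p 1 (a n - 1ℚ)

-- truncations of -1 ∈ ℤ_p : x_n = p^(n+1) - 1
digitsMinusOne : ℕ → ℕ → ℕ
digitsMinusOne p n = p ^ suc n ∸ 1

fSeqAtMinusOne : ℕ → ℕ → ℚ
fSeqAtMinusOne p n = f (digitsMinusOne p n)

-- f(n) = Σ_k C(n,k)⁻¹ satisfies 2 f(n+1) = 2 + (n+2)/(n+1) · f(n), which yields the
-- closed form f(N - 1) = F(N) := N/2^N · S(N) with S(N) = Σ_{k=1}^{N} 2^k/k, so the
-- sequence in question is F(p^(n+1)).
-- For p = 2, S(N) = Σ_{i<N} 2^(N+i+1) / ((N+i+1) C(N+i,i)), and every summand of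
-- F(2^M) then has 2-adic valuation at least M: the limit is 0.
-- For odd p, 2 is a p-adic unit, and F(N) - 1 = N/2^N · S(N-1) ≡ 0 (mod p) because
-- every summand carries a factor N/k with k < N = p^M. Splitting S(pN) into blocks of
-- p summands, all but the last summand 2^(pj)/(pj) of each block are divisible by
-- p^(M+1) after the factor pN/2^(pN); the last one differs from the summand 2^j/j of
-- F(N) by the factor 2^((p-1)(N-j)) ≡ 1 (mod p^(v_p(j)+1)), by Fermat's little theorem
-- lifted along powers of p. Hence v_p(F(p^(M+1)) - F(p^M)) ≥ M + 1.

{-# OPTIONS --safe #-}
module Submission where

open import Defs
open import Data.Nat as ℕ using (ℕ; zero; suc; NonZero; _^_; _<_; _≤_; _≥_; _∸_; _!; s≤s; z≤n; _≟_)
import Data.Nat.Properties as ℕP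
import Data.Nat.DivMod as ℕDivMod
open import Data.Nat.Divisibility as ∣ using (_∣_; divides; _∣?_)
open import Data.Nat.Primality using (Prime; prime[2]; euclidsLemma; prime⇒nonZero; prime⇒nonTrivial; ¬prime[1])
open import Data.Nat.Combinatorics using (_C_; nCk≡n!/k![n-k]!; k![n∸k]!∣n!; nCk+nC[k+1]≡[n+1]C[k+1]; k>n⇒nCk≡0; nCn≡1)
open import Data.Nat.Induction using (<-wellFounded)
import Data.Nat.GCD as GCD
import Data.Nat.Solver as ℕSolver
open import Data.Integer as ℤ using (ℤ; 0ℤ; 1ℤ; ∣_∣)
import Data.Integer.Properties as ℤP
import Data.Integer.Solver as ℤSolver
open import Data.Rational using (ℚ; _/_; _+_; _*_; -_; _-_; 0ℚ; 1ℚ; ½; ↥_; ↧_; ↧ₙ_; toℚᵘ)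
import Data.Rational.Properties as ℚP
import Data.Rational.Unnormalised as ℚᵘ
import Data.Rational.Unnormalised.Properties as ℚᵘP
import Data.Rational.Solver as ℚSolver
open import Data.List using (map; foldr; applyUpTo)
open import Data.Product using (Σ; ∃; _×_; _,_; proj₁; proj₂)
open import Data.Sum using (inj₁; inj₂; [_,_]′)
open import Data.Empty using (⊥-elim)
open import Function using (_∘_; id)
open import Induction.WellFounded using (Acc; acc)
open import Relation.Nullary using (¬_; yes; no)
open import Relation.Binary.PropositionalEquality hiding ([_]; J)

-- Opaque, so that the ring solver and the unifier treat these as atoms
-- instead of unfolding normalised fractions. The reciprocal is total
-- (inv 0 = 0ℚ), which makes inv-* hold without side conditions.
opaque
  fromℤ : ℤ → ℚ
  fromℤ i = i / 1

  fromℕ : ℕ → ℚ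
  fromℕ n = fromℤ (ℤ.+ n)

  inv : ℕ → ℚ
  inv = recipℕ

  recipℕ≡inv : ∀ n → recipℕ n ≡ inv n
  recipℕ≡inv n = refl

  fromℕ≡fromℤ : ∀ n → fromℕ n ≡ fromℤ (ℤ.+ n)
  fromℕ≡fromℤ n = refl

  fromℕ-0 : fromℕ 0 ≡ 0ℚ
  fromℕ-0 = refl

  fromℕ-1 : fromℕ 1 ≡ 1ℚ
  fromℕ-1 = refl

  inv-0 : inv 0 ≡ 0ℚ
  inv-0 = refl

  inv-1 : inv 1 ≡ 1ℚ
  inv-1 = refl

  private
    toℚᵘ-/ : ∀ i n → toℚᵘ (i / suc n) ℚᵘ.≃ ℚᵘ.mkℚᵘ i n
    toℚᵘ-/ i n = ℚP.toℚᵘ-fromℚᵘ (ℚᵘ.mkℚᵘ i n)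

  fromℤ-+ : ∀ a b → fromℤ (a ℤ.+ b) ≡ fromℤ a + fromℤ b
  fromℤ-+ a b = ℚP.toℚᵘ-injective (ℚᵘP.≃-trans (toℚᵘ-/ (a ℤ.+ b) 0)
    (ℚᵘP.≃-trans (ℚᵘ.*≡* eq) (ℚᵘP.≃-sym (ℚᵘP.≃-trans (ℚP.toℚᵘ-homo-+ (fromℤ a) (fromℤ b))
      (ℚᵘP.+-cong (toℚᵘ-/ a 0) (toℚᵘ-/ b 0))))))
    where
    open ℤSolver.+-*-Solver
    eq : (a ℤ.+ b) ℤ.* (1ℤ ℤ.* 1ℤ) ≡ (a ℤ.* 1ℤ ℤ.+ b ℤ.* 1ℤ) ℤ.* 1ℤ
    eq = solve 2 (λ a b → (a :+ b) :* (con 1ℤ :* con 1ℤ) := (a :* con 1ℤ :+ b :* con 1ℤ) :* con 1ℤ) refl a b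

  fromℤ-* : ∀ a b → fromℤ (a ℤ.* b) ≡ fromℤ a * fromℤ b
  fromℤ-* a b = ℚP.toℚᵘ-injective (ℚᵘP.≃-trans (toℚᵘ-/ (a ℤ.* b) 0)
    (ℚᵘP.≃-trans (ℚᵘ.*≡* eq) (ℚᵘP.≃-sym (ℚᵘP.≃-trans (ℚP.toℚᵘ-homo-* (fromℤ a) (fromℤ b))
      (ℚᵘP.*-cong (toℚᵘ-/ a 0) (toℚᵘ-/ b 0))))))
    where
    open ℤSolver.+-*-Solver
    eq : (a ℤ.* b) ℤ.* (1ℤ ℤ.* 1ℤ) ≡ (a ℤ.* b) ℤ.* 1ℤ
    eq = solve 2 (λ a b → (a :* b) :* (con 1ℤ :* con 1ℤ) := (a :* b) :* con 1ℤ) refl a b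

  fromℤ-neg : ∀ a → fromℤ (ℤ.- a) ≡ - fromℤ a
  fromℤ-neg a = ℚP.toℚᵘ-injective (ℚᵘP.≃-trans (toℚᵘ-/ (ℤ.- a) 0)
    (ℚᵘP.≃-sym (ℚᵘP.≃-trans (ℚP.toℚᵘ-homo‿- (fromℤ a)) (ℚᵘP.-‿cong (toℚᵘ-/ a 0)))))

  /≡fromℤ*inv : ∀ i n → .{{_ : NonZero n}} → i / n ≡ fromℤ i * inv n
  /≡fromℤ*inv i (suc n) = ℚP.toℚᵘ-injective (ℚᵘP.≃-trans (toℚᵘ-/ i n)
    (ℚᵘP.≃-trans (ℚᵘ.*≡* eq) (ℚᵘP.≃-sym (ℚᵘP.≃-trans (ℚP.toℚᵘ-homo-* (fromℤ i) (inv (suc n)))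
      (ℚᵘP.*-cong (toℚᵘ-/ i 0) (toℚᵘ-/ 1ℤ n))))))
    where
    open ℤSolver.+-*-Solver
    eq : i ℤ.* (1ℤ ℤ.* ℤ.+ suc n) ≡ (i ℤ.* 1ℤ) ℤ.* ℤ.+ suc n
    eq = solve 2 (λ a b → a :* (con 1ℤ :* b) := (a :* con 1ℤ) :* b) refl i (ℤ.+ suc n)

  fromℕ*inv≡1 : ∀ n → .{{_ : NonZero n}} → fromℕ n * inv n ≡ 1ℚ
  fromℕ*inv≡1 (suc n) = trans (sym (/≡fromℤ*inv (ℤ.+ suc n) (suc n)))
    (ℚP.toℚᵘ-injective (ℚᵘP.≃-trans (toℚᵘ-/ (ℤ.+ suc n) n) (ℚᵘ.*≡* (ℤP.*-comm (ℤ.+ suc n) 1ℤ))))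

-- The ring solver cannot use hypotheses: a relation x ≡ y is fed to it by
-- exhibiting L as R plus a multiple of x - y.
≡-modulo : ∀ {L R} c {x y} → x ≡ y → L ≡ R + c * (x - y) → L ≡ R
≡-modulo {L} {R} c {x} refl e = trans e (lem R c x)
  where
  open ℚSolver.+-*-Solver
  lem : ∀ R c x → R + c * (x - x) ≡ R
  lem = solve 3 (λ R c x → R :+ c :* (x :- x) := R) refl

fromℕ-+ : ∀ a b → fromℕ (a ℕ.+ b) ≡ fromℕ a + fromℕ b
fromℕ-+ a b = begin
  fromℕ (a ℕ.+ b)               ≡⟨ fromℕ≡fromℤ (a ℕ.+ b) ⟩
  fromℤ (ℤ.+ (a ℕ.+ b))         ≡⟨ cong fromℤ (ℤP.pos-+ a b) ⟩
  fromℤ (ℤ.+ a ℤ.+ ℤ.+ b)       ≡⟨ fromℤ-+ (ℤ.+ a) (ℤ.+ b) ⟩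
  fromℤ (ℤ.+ a) + fromℤ (ℤ.+ b) ≡⟨ sym (cong₂ _+_ (fromℕ≡fromℤ a) (fromℕ≡fromℤ b)) ⟩
  fromℕ a + fromℕ b             ∎
  where open ≡-Reasoning

fromℕ-* : ∀ a b → fromℕ (a ℕ.* b) ≡ fromℕ a * fromℕ b
fromℕ-* a b = begin
  fromℕ (a ℕ.* b)               ≡⟨ fromℕ≡fromℤ (a ℕ.* b) ⟩
  fromℤ (ℤ.+ (a ℕ.* b))         ≡⟨ cong fromℤ (ℤP.pos-* a b) ⟩
  fromℤ (ℤ.+ a ℤ.* ℤ.+ b)       ≡⟨ fromℤ-* (ℤ.+ a) (ℤ.+ b) ⟩
  fromℤ (ℤ.+ a) * fromℤ (ℤ.+ b) ≡⟨ sym (cong₂ _*_ (fromℕ≡fromℤ a) (fromℕ≡fromℤ b)) ⟩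
  fromℕ a * fromℕ b             ∎
  where open ≡-Reasoning

fromℕ-2 : fromℕ 2 ≡ 1ℚ + 1ℚ
fromℕ-2 = trans (fromℕ-+ 1 1) (cong₂ _+_ fromℕ-1 fromℕ-1)

inv-unique : ∀ n → .{{_ : NonZero n}} → ∀ x → fromℕ n * x ≡ 1ℚ → x ≡ inv n
inv-unique n x nx≡1 = ≡-modulo (inv n) nx≡1 (lem x (fromℕ n) (inv n) (fromℕ*inv≡1 n))
  where
  lem : ∀ x a b → a * b ≡ 1ℚ → x ≡ b + b * (a * x - 1ℚ)
  lem x a b ab≡1 = ≡-modulo (- x) ab≡1 (solve 3 (λ x a b → x := b :+ b :* (a :* x :- con 1ℚ) :+ (:- x) :* (a :* b :- con 1ℚ)) refl x a b)
    where open ℚSolver.+-*-Solver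

inv-* : ∀ m n → inv (m ℕ.* n) ≡ inv m * inv n
inv-* zero n = trans inv-0 (sym (trans (cong (_* inv n) inv-0) (ℚP.*-zeroˡ (inv n))))
inv-* (suc m) zero = begin
  inv (m ℕ.* 0)    ≡⟨ cong inv (ℕP.*-zeroʳ m) ⟩
  inv 0            ≡⟨ inv-0 ⟩
  0ℚ               ≡⟨ sym (ℚP.*-zeroʳ (inv (suc m))) ⟩
  inv (suc m) * 0ℚ ≡⟨ cong (inv (suc m) *_) (sym inv-0) ⟩
  inv (suc m) * inv 0 ∎
  where open ≡-Reasoning
inv-* m@(suc _) n@(suc _) = sym (inv-unique (m ℕ.* n) (inv m * inv n)
  (≡-modulo (fromℕ m * inv m) (fromℕ*inv≡1 n) (≡-modulo 1ℚ (fromℕ*inv≡1 m)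
    (trans (cong (_* (inv m * inv n)) (fromℕ-* m n)) (lem (fromℕ m) (fromℕ n) (inv m) (inv n))))))
  where
  open ℚSolver.+-*-Solver
  lem : ∀ a b c d → (a * b) * (c * d) ≡ 1ℚ + a * c * (b * d - 1ℚ) + 1ℚ * (a * c - 1ℚ)
  lem = solve 4 (λ a b c d → (a :* b) :* (c :* d) := con 1ℚ :+ a :* c :* (b :* d :- con 1ℚ) :+ con 1ℚ :* (a :* c :- con 1ℚ)) refl

fraction-cancelˡ : ∀ m x y → .{{_ : NonZero m}} → fromℕ (m ℕ.* x) * inv (m ℕ.* y) ≡ fromℕ x * inv y
fraction-cancelˡ m x y = trans (cong₂ _*_ (fromℕ-* m x) (inv-* m y))
  (≡-modulo (fromℕ x * inv y) (fromℕ*inv≡1 m) (lem (fromℕ m) (fromℕ x) (inv m) (inv y)))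
  where
  open ℚSolver.+-*-Solver
  lem : ∀ a b c d → a * b * (c * d) ≡ b * d + b * d * (a * c - 1ℚ)
  lem = solve 4 (λ a b c d → a :* b :* (c :* d) := b :* d :+ b :* d :* (a :* c :- con 1ℚ)) refl

inv-factor : ∀ {c u N} .{{_ : NonZero N}} → c ℕ.* u ≡ N → inv c ≡ fromℕ u * inv N
inv-factor {zero} {u} {suc N} ()
inv-factor {c@(suc _)} {u} {N} cu≡N = sym (inv-unique c (fromℕ u * inv N) (begin
  fromℕ c * (fromℕ u * inv N) ≡⟨ sym (ℚP.*-assoc (fromℕ c) (fromℕ u) (inv N)) ⟩
  fromℕ c * fromℕ u * inv N   ≡⟨ cong (_* inv N) (trans (sym (fromℕ-* c u)) (cong fromℕ cu≡N)) ⟩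
  fromℕ N * inv N             ≡⟨ fromℕ*inv≡1 N ⟩
  1ℚ                          ∎))
  where open ≡-Reasoning

double-injective : ∀ {x y : ℚ} → x + x ≡ y + y → x ≡ y
double-injective {x} {y} eq = begin
  x           ≡⟨ solve 1 (λ x → x := con ½ :* (x :+ x)) refl x ⟩
  ½ * (x + x) ≡⟨ cong (½ *_) eq ⟩
  ½ * (y + y) ≡⟨ solve 1 (λ y → con ½ :* (y :+ y) := y) refl y ⟩
  y           ∎
  where
  open ≡-Reasoning
  open ℚSolver.+-*-Solver

∑ : ℕ → (ℕ → ℚ) → ℚ
∑ zero g = 0ℚ
∑ (suc n) g = ∑ n g + g n

∑-cong : ∀ n {g h : ℕ → ℚ} → (∀ i → i < n → g i ≡ h i) → ∑ n g ≡ ∑ n h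
∑-cong zero eq = refl
∑-cong (suc n) eq = cong₂ _+_ (∑-cong n (λ i i<n → eq i (ℕP.m<n⇒m<1+n i<n))) (eq n ℕP.≤-refl)

∑-suc : ∀ n g → ∑ (suc n) g ≡ g 0 + ∑ n (g ∘ suc)
∑-suc zero g = trans (ℚP.+-identityˡ (g 0)) (sym (ℚP.+-identityʳ (g 0)))
∑-suc (suc n) g = trans (cong (_+ g (suc n)) (∑-suc n g)) (ℚP.+-assoc (g 0) (∑ n (g ∘ suc)) (g (suc n)))

∑-+ : ∀ n g h → ∑ n (λ i → g i + h i) ≡ ∑ n g + ∑ n h
∑-+ zero g h = refl
∑-+ (suc n) g h = trans (cong (_+ (g n + h n)) (∑-+ n g h)) (lem (∑ n g) (∑ n h) (g n) (h n))
  where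
  open ℚSolver.+-*-Solver
  lem : ∀ a b c d → a + b + (c + d) ≡ a + c + (b + d)
  lem = solve 4 (λ a b c d → a :+ b :+ (c :+ d) := a :+ c :+ (b :+ d)) refl

∑-- : ∀ n g h → ∑ n (λ i → g i - h i) ≡ ∑ n g - ∑ n h
∑-- zero g h = refl
∑-- (suc n) g h = trans (cong (_+ (g n - h n)) (∑-- n g h)) (lem (∑ n g) (∑ n h) (g n) (h n))
  where
  open ℚSolver.+-*-Solver
  lem : ∀ a b c d → a - b + (c - d) ≡ a + c - (b + d)
  lem = solve 4 (λ a b c d → a :- b :+ (c :- d) := a :+ c :- (b :+ d)) refl

∑-*ˡ : ∀ n c g → c * ∑ n g ≡ ∑ n (λ i → c * g i)
∑-*ˡ zero c g = ℚP.*-zeroʳ c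
∑-*ˡ (suc n) c g = trans (ℚP.*-distribˡ-+ c (∑ n g) (g n)) (cong (_+ c * g n) (∑-*ˡ n c g))

∑-*ʳ : ∀ n c g → ∑ n g * c ≡ ∑ n (λ i → g i * c)
∑-*ʳ n c g = trans (ℚP.*-comm (∑ n g) c) (trans (∑-*ˡ n c g) (∑-cong n (λ i _ → ℚP.*-comm c (g i))))

∑-+ₙ : ∀ m n g → ∑ (m ℕ.+ n) g ≡ ∑ m g + ∑ n (λ i → g (m ℕ.+ i))
∑-+ₙ m zero g = trans (cong (λ k → ∑ k g) (ℕP.+-identityʳ m)) (sym (ℚP.+-identityʳ (∑ m g)))
∑-+ₙ m (suc n) g = trans (cong (λ k → ∑ k g) (ℕP.+-suc m n))
  (trans (cong (_+ g (m ℕ.+ n)) (∑-+ₙ m n g)) (ℚP.+-assoc (∑ m g) _ _))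

∑-*ₙ : ∀ m n g → ∑ (m ℕ.* n) g ≡ ∑ n (λ q → ∑ m (λ r → g (m ℕ.* q ℕ.+ r)))
∑-*ₙ m zero g = cong (λ k → ∑ k g) (ℕP.*-zeroʳ m)
∑-*ₙ m (suc n) g = trans (cong (λ k → ∑ k g) (trans (ℕP.*-suc m n) (ℕP.+-comm m (m ℕ.* n))))
  (trans (∑-+ₙ (m ℕ.* n) m g) (cong (_+ ∑ m (λ r → g (m ℕ.* n ℕ.+ r))) (∑-*ₙ m n g)))

foldr-applyUpTo≡∑ : ∀ n (h : ℕ → ℚ) (g : ℕ → ℕ) → foldr _+_ 0ℚ (map h (applyUpTo g n)) ≡ ∑ n (h ∘ g)
foldr-applyUpTo≡∑ zero h g = refl
foldr-applyUpTo≡∑ (suc n) h g =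
  trans (cong (λ z → h (g 0) + z) (foldr-applyUpTo≡∑ n h (g ∘ suc))) (sym (∑-suc n (h ∘ g)))

-- Lower bounds for the p-adic valuation

-- An unnormalised form of ValGe (x ∈ p^k ℤ₍ₚ₎), closed under the ring operations.
record Val≥ (p k : ℕ) (x : ℚ) : Set where
  constructor val≥
  field
    num : ℤ
    den : ℕ
    p∤den : ¬ p ∣ den
    ≡frac : x ≡ fromℕ (p ^ k) * fromℤ num * inv den

module _ {p : ℕ} (pp : Prime p) where

  p∤⇒nonZero : ∀ {n} → ¬ p ∣ n → NonZero n
  p∤⇒nonZero {zero} p∤0 = ⊥-elim (p∤0 (p ∣.∣0))
  p∤⇒nonZero {suc n} _ = _

  p∤1 : ¬ p ∣ 1
  p∤1 p∣1 with ∣.∣1⇒≡1 p∣1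
  ... | refl = ¬prime[1] pp

  p∤* : ∀ {m n} → ¬ p ∣ m → ¬ p ∣ n → ¬ p ∣ m ℕ.* n
  p∤* {m} {n} p∤m p∤n p∣mn = [ p∤m , p∤n ]′ (euclidsLemma m n pp p∣mn)

  p^k∣m*n⇒p^k∣m : ∀ k u g → ¬ p ∣ g → p ^ k ∣ u ℕ.* g → p ^ k ∣ u
  p^k∣m*n⇒p^k∣m zero u g _ _ = ∣.1∣ u
  p^k∣m*n⇒p^k∣m (suc k) u g p∤g p^k∣ug with euclidsLemma u g pp (∣.∣-trans (∣.m∣m*n (p ^ k)) p^k∣ug)
  ... | inj₂ p∣g = ⊥-elim (p∤g p∣g)
  ... | inj₁ (divides u′ refl) = subst (p ^ suc k ∣_) (ℕP.*-comm p u′) (∣.*-monoʳ-∣ p p^k∣u′)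
    where
    instance _ = prime⇒nonZero pp
    p^k∣u′ : p ^ k ∣ u′
    p^k∣u′ = p^k∣m*n⇒p^k∣m k u′ g p∤g (∣.*-cancelˡ-∣ p
      (subst (p ℕ.* p ^ k ∣_) (trans (cong (ℕ._* g) (ℕP.*-comm u′ p)) (ℕP.*-assoc p u′ g)) p^k∣ug))

  -- Normalising p^k a / c divides numerator and denominator by a g ∣ c, so p ∤ g.
  Val≥⇒ValGe : ∀ {k x} → Val≥ p k x → ValGe p k x
  Val≥⇒ValGe {k} {x} (val≥ a c p∤c x≡) = p^k∣num , p∤den
    where
    instance _ = p∤⇒nonZero p∤c
    i = ℤ.+ (p ^ k) ℤ.* a
    x≡i/c : x ≡ i / c
    x≡i/c = trans x≡ (trans (cong (_* inv c) (trans (cong (_* fromℤ a) (fromℕ≡fromℤ (p ^ k)))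
      (sym (fromℤ-* (ℤ.+ (p ^ k)) a)))) (sym (/≡fromℤ*inv i c)))
    g = GCD.gcd ∣ i ∣ c
    num*g : ∣ ↥ x ∣ ℕ.* g ≡ p ^ k ℕ.* ∣ a ∣
    num*g = trans (sym (ℤP.abs-* (↥ x) (ℤ.+ g)))
      (trans (cong ∣_∣ (trans (cong (λ y → ↥ y ℤ.* ℤ.+ g) x≡i/c) (ℚP.↥-/ i c))) (ℤP.abs-* (ℤ.+ (p ^ k)) a))
    den*g : ↧ₙ x ℕ.* g ≡ c
    den*g = trans (sym (ℤP.abs-* (↧ x) (ℤ.+ g))) (cong ∣_∣ (trans (cong (λ y → ↧ y ℤ.* ℤ.+ g) x≡i/c) (ℚP.↧-/ i c)))
    p∤g : ¬ p ∣ g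
    p∤g p∣g = p∤c (∣.∣-trans p∣g (divides (↧ₙ x) (sym den*g)))
    p^k∣num : p ^ k ∣ ∣ ↥ x ∣
    p^k∣num = p^k∣m*n⇒p^k∣m k ∣ ↥ x ∣ g p∤g (divides ∣ a ∣ (trans num*g (ℕP.*-comm (p ^ k) ∣ a ∣)))
    p∤den : ¬ p ∣ ↧ₙ x
    p∤den p∣den = p∤c (∣.∣-trans p∣den (divides g (trans (sym den*g) (ℕP.*-comm (↧ₙ x) g))))

  Val≥-0 : ∀ k → Val≥ p k 0ℚ
  Val≥-0 k = val≥ 0ℤ 1 p∤1 (sym (begin
    fromℕ (p ^ k) * fromℤ 0ℤ * inv 1 ≡⟨ cong₂ (λ a b → fromℕ (p ^ k) * a * b) (trans (sym (fromℕ≡fromℤ 0)) fromℕ-0) inv-1 ⟩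
    fromℕ (p ^ k) * 0ℚ * 1ℚ          ≡⟨ solve 1 (λ a → a :* con 0ℚ :* con 1ℚ := con 0ℚ) refl (fromℕ (p ^ k)) ⟩
    0ℚ                               ∎))
    where
    open ≡-Reasoning
    open ℚSolver.+-*-Solver

  Val≥-p^ : ∀ k → Val≥ p k (fromℕ (p ^ k))
  Val≥-p^ k = val≥ 1ℤ 1 p∤1 (sym (begin
    fromℕ (p ^ k) * fromℤ 1ℤ * inv 1 ≡⟨ cong₂ (λ a b → fromℕ (p ^ k) * a * b) (trans (sym (fromℕ≡fromℤ 1)) fromℕ-1) inv-1 ⟩
    fromℕ (p ^ k) * 1ℚ * 1ℚ          ≡⟨ solve 1 (λ a → a :* con 1ℚ :* con 1ℚ := a) refl (fromℕ (p ^ k)) ⟩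
    fromℕ (p ^ k)                    ∎))
    where
    open ≡-Reasoning
    open ℚSolver.+-*-Solver

  Val≥-fromℕ : ∀ n → Val≥ p 0 (fromℕ n)
  Val≥-fromℕ n = val≥ (ℤ.+ n) 1 p∤1 (sym (begin
    fromℕ 1 * fromℤ (ℤ.+ n) * inv 1 ≡⟨ cong₂ (λ a b → a * fromℤ (ℤ.+ n) * b) fromℕ-1 inv-1 ⟩
    1ℚ * fromℤ (ℤ.+ n) * 1ℚ         ≡⟨ solve 1 (λ a → con 1ℚ :* a :* con 1ℚ := a) refl (fromℤ (ℤ.+ n)) ⟩
    fromℤ (ℤ.+ n)                   ≡⟨ sym (fromℕ≡fromℤ n) ⟩
    fromℕ n                         ∎))
    where
    open ≡-Reasoning
    open ℚSolver.+-*-Solver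

  Val≥-inv : ∀ {n} → ¬ p ∣ n → Val≥ p 0 (inv n)
  Val≥-inv {n} p∤n = val≥ 1ℤ n p∤n (sym (begin
    fromℕ 1 * fromℤ 1ℤ * inv n ≡⟨ cong₂ (λ a b → a * b * inv n) fromℕ-1 (trans (sym (fromℕ≡fromℤ 1)) fromℕ-1) ⟩
    1ℚ * 1ℚ * inv n            ≡⟨ solve 1 (λ a → con 1ℚ :* con 1ℚ :* a := a) refl (inv n) ⟩
    inv n                      ∎))
    where
    open ≡-Reasoning
    open ℚSolver.+-*-Solver

  Val≥-neg : ∀ {k x} → Val≥ p k x → Val≥ p k (- x)
  Val≥-neg {k} {x} (val≥ a c p∤c x≡) = val≥ (ℤ.- a) c p∤c (begin
    - x                 ≡⟨ cong -_ x≡ ⟩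
    - (P * fromℤ a * I) ≡⟨ solve 3 (λ P a I → :- (P :* a :* I) := P :* (:- a) :* I) refl P (fromℤ a) I ⟩
    P * (- fromℤ a) * I ≡⟨ cong (λ z → P * z * I) (sym (fromℤ-neg a)) ⟩
    P * fromℤ (ℤ.- a) * I ∎)
    where
    open ≡-Reasoning
    open ℚSolver.+-*-Solver
    P = fromℕ (p ^ k)
    I = inv c

  Val≥-+ : ∀ {k x y} → Val≥ p k x → Val≥ p k y → Val≥ p k (x + y)
  Val≥-+ {k} {x} {y} (val≥ a c p∤c x≡) (val≥ b d p∤d y≡) =
    val≥ (a ℤ.* ℤ.+ d ℤ.+ b ℤ.* ℤ.+ c) (c ℕ.* d) (p∤* p∤c p∤d) (begin
      x + y                                     ≡⟨ cong₂ _+_ x≡ y≡ ⟩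
      P * A * I + P * B * J                     ≡⟨ ≡-modulo (- (P * A * I)) (fromℕ*inv≡1 d) (≡-modulo (- (P * B * J)) (fromℕ*inv≡1 c)
                                                   (lem P A B I J (fromℕ c) (fromℕ d))) ⟩
      P * (A * fromℕ d + B * fromℕ c) * (I * J) ≡⟨ cong₂ (λ u v → P * u * v) (sym numerator) (sym (inv-* c d)) ⟩
      P * fromℤ (a ℤ.* ℤ.+ d ℤ.+ b ℤ.* ℤ.+ c) * inv (c ℕ.* d) ∎)
    where
    open ≡-Reasoning
    open ℚSolver.+-*-Solver
    instance
      _ = p∤⇒nonZero p∤c
      _ = p∤⇒nonZero p∤d
    P = fromℕ (p ^ k)
    A = fromℤ a
    B = fromℤ b
    I = inv c
    J = inv d
    lem : ∀ P A B I J c′ d′ → P * A * I + P * B * J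
      ≡ P * (A * d′ + B * c′) * (I * J) + - (P * A * I) * (d′ * J - 1ℚ) + - (P * B * J) * (c′ * I - 1ℚ)
    lem = solve 7 (λ P A B I J c′ d′ → P :* A :* I :+ P :* B :* J
      := P :* (A :* d′ :+ B :* c′) :* (I :* J) :+ :- (P :* A :* I) :* (d′ :* J :- con 1ℚ) :+ :- (P :* B :* J) :* (c′ :* I :- con 1ℚ)) refl
    numerator : fromℤ (a ℤ.* ℤ.+ d ℤ.+ b ℤ.* ℤ.+ c) ≡ A * fromℕ d + B * fromℕ c
    numerator = trans (fromℤ-+ (a ℤ.* ℤ.+ d) (b ℤ.* ℤ.+ c)) (cong₂ _+_
      (trans (fromℤ-* a (ℤ.+ d)) (cong (A *_) (sym (fromℕ≡fromℤ d))))
      (trans (fromℤ-* b (ℤ.+ c)) (cong (B *_) (sym (fromℕ≡fromℤ c)))))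

  Val≥-- : ∀ {k x y} → Val≥ p k x → Val≥ p k y → Val≥ p k (x - y)
  Val≥-- vx vy = Val≥-+ vx (Val≥-neg vy)

  Val≥-* : ∀ {k l x y} → Val≥ p k x → Val≥ p l y → Val≥ p (k ℕ.+ l) (x * y)
  Val≥-* {k} {l} {x} {y} (val≥ a c p∤c x≡) (val≥ b d p∤d y≡) = val≥ (a ℤ.* b) (c ℕ.* d) (p∤* p∤c p∤d) (begin
    x * y                                             ≡⟨ cong₂ _*_ x≡ y≡ ⟩
    (P * fromℤ a * I) * (Q * fromℤ b * J)             ≡⟨ solve 6 (λ P a I Q b J → (P :* a :* I) :* (Q :* b :* J) := (P :* Q) :* (a :* b) :* (I :* J))
                                                         refl P (fromℤ a) I Q (fromℤ b) J ⟩
    (P * Q) * (fromℤ a * fromℤ b) * (I * J)           ≡⟨ cong₂ (λ u v → u * v * (I * J)) (sym pk+l) (sym (fromℤ-* a b)) ⟩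
    fromℕ (p ^ (k ℕ.+ l)) * fromℤ (a ℤ.* b) * (I * J) ≡⟨ cong (fromℕ (p ^ (k ℕ.+ l)) * fromℤ (a ℤ.* b) *_) (sym (inv-* c d)) ⟩
    fromℕ (p ^ (k ℕ.+ l)) * fromℤ (a ℤ.* b) * inv (c ℕ.* d) ∎)
    where
    open ≡-Reasoning
    open ℚSolver.+-*-Solver
    P = fromℕ (p ^ k)
    Q = fromℕ (p ^ l)
    I = inv c
    J = inv d
    pk+l : fromℕ (p ^ (k ℕ.+ l)) ≡ P * Q
    pk+l = trans (cong fromℕ (ℕP.^-distribˡ-+-* p k l)) (fromℕ-* (p ^ k) (p ^ l))

  Val≥-*-unit : ∀ {k x y} → Val≥ p k x → Val≥ p 0 y → Val≥ p k (x * y)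
  Val≥-*-unit {k} vx vy = subst (λ l → Val≥ p l _) (ℕP.+-identityʳ k) (Val≥-* vx vy)

  Val≥-weaken : ∀ {k l x} → l ≤ k → Val≥ p k x → Val≥ p l x
  Val≥-weaken {k} {l} {x} l≤k (val≥ a c p∤c x≡) = val≥ (ℤ.+ (p ^ (k ℕ.∸ l)) ℤ.* a) c p∤c (begin
    x                           ≡⟨ x≡ ⟩
    fromℕ (p ^ k) * A * I       ≡⟨ cong (λ z → z * A * I) p^k≡ ⟩
    fromℕ (p ^ l) * E * A * I   ≡⟨ cong (_* I) (ℚP.*-assoc (fromℕ (p ^ l)) E A) ⟩
    fromℕ (p ^ l) * (E * A) * I ≡⟨ cong (λ z → fromℕ (p ^ l) * z * I) (sym numerator) ⟩
    fromℕ (p ^ l) * fromℤ (ℤ.+ (p ^ (k ℕ.∸ l)) ℤ.* a) * I ∎)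
    where
    open ≡-Reasoning
    A = fromℤ a
    E = fromℕ (p ^ (k ℕ.∸ l))
    I = inv c
    p^k≡ : fromℕ (p ^ k) ≡ fromℕ (p ^ l) * E
    p^k≡ = trans (cong (λ i → fromℕ (p ^ i)) (sym (ℕP.m+[n∸m]≡n l≤k)))
      (trans (cong fromℕ (ℕP.^-distribˡ-+-* p l (k ℕ.∸ l))) (fromℕ-* (p ^ l) (p ^ (k ℕ.∸ l))))
    numerator : fromℤ (ℤ.+ (p ^ (k ℕ.∸ l)) ℤ.* a) ≡ E * A
    numerator = trans (fromℤ-* (ℤ.+ (p ^ (k ℕ.∸ l))) a) (cong (_* A) (sym (fromℕ≡fromℤ (p ^ (k ℕ.∸ l)))))

  Val≥-∑ : ∀ {k} n g → (∀ i → i < n → Val≥ p k (g i)) → Val≥ p k (∑ n g)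
  Val≥-∑ {k} zero g _ = Val≥-0 k
  Val≥-∑ {k} (suc n) g v = Val≥-+ (Val≥-∑ n g (λ i i<n → v i (ℕP.m<n⇒m<1+n i<n))) (v n ℕP.≤-refl)

-- p-parts of natural numbers

record PPart (p J : ℕ) : Set where
  constructor pPart
  field
    exp unit : ℕ
    J≡p^exp*unit : J ≡ p ^ exp ℕ.* unit
    p∤unit : ¬ p ∣ unit
open PPart

^-split : ∀ p {t M} → t ≤ M → p ^ M ≡ p ^ t ℕ.* p ^ (M ∸ t)
^-split p {t} {M} t≤M = trans (cong (p ^_) (sym (ℕP.m+[n∸m]≡n t≤M))) (ℕP.^-distribˡ-+-* p t (M ∸ t))

module _ {p : ℕ} (1<p : 1 < p) where

  private instance
    p≢0 : NonZero p
    p≢0 = ℕ.>-nonZero (ℕP.<-trans (s≤s z≤n) 1<p)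

  n<p^n : ∀ n → n < p ^ n
  n<p^n zero = s≤s z≤n
  n<p^n (suc n) = ℕP.≤-trans (s≤s (n<p^n n)) (ℕP.≤-trans 1+p^n≤2*p^n (ℕP.*-monoˡ-≤ (p ^ n) 1<p))
    where
    1+p^n≤2*p^n : suc (p ^ n) ≤ 2 ℕ.* p ^ n
    1+p^n≤2*p^n = subst (λ z → suc (p ^ n) ≤ p ^ n ℕ.+ z) (sym (ℕP.+-identityʳ (p ^ n)))
      (subst (_≤ p ^ n ℕ.+ p ^ n) (ℕP.+-comm (p ^ n) 1) (ℕP.+-monoʳ-≤ (p ^ n) (ℕP.m^n>0 p n)))

  ^-cancelʳ-< : ∀ {t M} → p ^ t < p ^ M → t < M
  ^-cancelʳ-< {t} {M} p^t<p^M with ℕP.<-≤-connex t M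
  ... | inj₁ t<M = t<M
  ... | inj₂ M≤t = ⊥-elim (ℕP.<⇒≱ p^t<p^M (ℕP.^-monoʳ-≤ p M≤t))

  toPPart : ∀ J → 0 < J → PPart p J
  toPPart J = go J (<-wellFounded J)
    where
    go : ∀ J → Acc _<_ J → 0 < J → PPart p J
    go J (acc rec) 0<J with p ∣? J
    ... | no p∤J = pPart 0 J (sym (ℕP.*-identityˡ J)) p∤J
    ... | yes (divides J′ J≡J′p) with go J′ (rec J′<J) 0<J′
      where
      0<J′ : 0 < J′
      0<J′ = ℕP.n≢0⇒n>0 (λ J′≡0 → ℕP.<⇒≢ 0<J (sym (trans J≡J′p (cong (ℕ._* p) J′≡0))))
      J′<J : J′ < J
      J′<J = subst (J′ <_) (sym J≡J′p) (ℕP.m<m*n J′ p {{ℕ.>-nonZero 0<J′}} 1<p)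
    ... | pPart t u J′≡ p∤u = pPart (suc t) u (trans J≡J′p (trans (cong (ℕ._* p) J′≡) reassoc)) p∤u
      where
      reassoc : p ^ t ℕ.* u ℕ.* p ≡ p ℕ.* p ^ t ℕ.* u
      reassoc = trans (ℕP.*-comm (p ^ t ℕ.* u) p) (sym (ℕP.*-assoc p (p ^ t) u))

  p^exp≤ : ∀ {J} (d : PPart p J) → p ^ exp d ≤ J
  p^exp≤ (pPart t zero J≡ p∤u) = ⊥-elim (p∤u (p ∣.∣0))
  p^exp≤ (pPart t (suc u) J≡ p∤u) = subst (p ^ t ≤_) (sym J≡) (ℕP.m≤m*n (p ^ t) (suc u))

  exp< : ∀ {J M} (d : PPart p J) → J < p ^ M → exp d < M
  exp< d J<p^M = ^-cancelʳ-< (ℕP.≤-<-trans (p^exp≤ d) J<p^M)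

  exp<J : ∀ {J} (d : PPart p J) → exp d < J
  exp<J d = ℕP.<-≤-trans (n<p^n (exp d)) (p^exp≤ d)

  PPart-p^+ : ∀ {J} M (d : PPart p J) → exp d < M → PPart p (p ^ M ℕ.+ J)
  PPart-p^+ M (pPart t u J≡ p∤u) t<M = pPart t (p ^ (M ∸ t) ℕ.+ u)
    (trans (cong₂ ℕ._+_ (^-split p (ℕP.<⇒≤ t<M)) J≡) (sym (ℕP.*-distribˡ-+ (p ^ t) (p ^ (M ∸ t)) u)))
    p∤sum
    where
    p∤sum : ¬ p ∣ p ^ (M ∸ t) ℕ.+ u
    p∤sum p∣sum with M ∸ t | ℕP.m<n⇒0<n∸m t<M
    ... | suc e | _ = p∤u (∣.∣m+n∣m⇒∣n p∣sum (∣.m∣m*n (p ^ e)))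

module _ {p : ℕ} (pp : Prime p) where

  private
    instance
      p≢0 : NonZero p
      p≢0 = prime⇒nonZero pp
    1<p : 1 < p
    1<p = ℕ.nonTrivial⇒n>1 p {{prime⇒nonTrivial pp}}

  Val≥-p^/ : ∀ a {J} (d : PPart p J) → exp d ≤ a → Val≥ p (a ∸ exp d) (fromℕ (p ^ a) * inv J)
  Val≥-p^/ a (pPart t u J≡ p∤u) t≤a = subst (Val≥ p (a ∸ t)) (sym eq)
    (Val≥-*-unit pp (Val≥-p^ pp (a ∸ t)) (Val≥-inv pp p∤u))
    where
    eq : fromℕ (p ^ a) * inv _ ≡ fromℕ (p ^ (a ∸ t)) * inv u
    eq = trans (cong₂ (λ x y → fromℕ x * inv y) (^-split p t≤a) J≡) (fraction-cancelˡ (p ^ t) (p ^ (a ∸ t)) u {{ℕP.m^n≢0 p t}})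

  Val≥-sameExp/ : ∀ {J K} (d : PPart p J) (e : PPart p K) → exp d ≡ exp e → Val≥ p 0 (fromℕ J * inv K)
  Val≥-sameExp/ (pPart t u J≡ _) (pPart .t v K≡ p∤v) refl = subst (Val≥ p 0) (sym eq)
    (Val≥-*-unit pp (Val≥-fromℕ pp u) (Val≥-inv pp p∤v))
    where
    eq : fromℕ _ * inv _ ≡ fromℕ u * inv v
    eq = trans (cong₂ (λ x y → fromℕ x * inv y) J≡ K≡) (fraction-cancelˡ (p ^ t) u v {{ℕP.m^n≢0 p t}})

  Val≥-/p^+ : ∀ M {J} (d : PPart p J) → exp d < M → Val≥ p 0 (fromℕ J * inv (p ^ M ℕ.+ J))
  Val≥-/p^+ M d@(pPart _ _ _ _) t<M = Val≥-sameExp/ d (PPart-p^+ 1<p M d t<M) refl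

-- A closed form of f

nCk*k![n∸k]!≡n! : ∀ {n k} → k ≤ n → (n C k) ℕ.* (k ! ℕ.* (n ∸ k) !) ≡ n !
nCk*k![n∸k]!≡n! {n} {k} k≤n = trans (cong (ℕ._* (k ! ℕ.* (n ∸ k) !)) (nCk≡n!/k![n-k]! k≤n))
  (ℕDivMod.m/n*n≡m {{k ℕP.!* (n ∸ k) !≢0}} (k![n∸k]!∣n! k≤n))

factorial-pascal : ∀ n k → k ≤ n →
  k ! ℕ.* (suc n ∸ k) ! ℕ.+ suc k ! ℕ.* (n ∸ k) ! ≡ (2 ℕ.+ n) ℕ.* (k ! ℕ.* (n ∸ k) !)
factorial-pascal n k k≤n rewrite ℕP.+-∸-assoc 1 k≤n =
  trans (lem (k !) ((n ∸ k) !) (n ∸ k) k) (cong (λ m → (2 ℕ.+ m) ℕ.* (k ! ℕ.* (n ∸ k) !)) (ℕP.m∸n+n≡m k≤n))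
  where
  open ℕSolver.+-*-Solver
  lem : ∀ a b d k → a ℕ.* (suc d ℕ.* b) ℕ.+ (suc k ℕ.* a) ℕ.* b ≡ (2 ℕ.+ (d ℕ.+ k)) ℕ.* (a ℕ.* b)
  lem = solve 4 (λ a b d k → a :* ((con 1 :+ d) :* b) :+ ((con 1 :+ k) :* a) :* b := (con 2 :+ (d :+ k)) :* (a :* b)) refl

facSum : ℕ → ℚ
facSum n = ∑ (suc n) (λ k → fromℕ (k ! ℕ.* (n ∸ k) !))

f≡facSum*inv : ∀ n → f n ≡ facSum n * inv (n !)
f≡facSum*inv n = begin
  f n                                                     ≡⟨ foldr-applyUpTo≡∑ (suc n) (λ k → recipℕ (n C k)) id ⟩
  ∑ (suc n) (λ k → recipℕ (n C k))                        ≡⟨ ∑-cong (suc n) (λ k k≤n → trans (recipℕ≡inv (n C k))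
                                                             (inv-factor {{n ℕP.!≢0}} (nCk*k![n∸k]!≡n! (ℕP.≤-pred k≤n)))) ⟩
  ∑ (suc n) (λ k → fromℕ (k ! ℕ.* (n ∸ k) !) * inv (n !)) ≡⟨ sym (∑-*ʳ (suc n) (inv (n !)) _) ⟩
  facSum n * inv (n !)                                    ∎
  where open ≡-Reasoning

facSum-rec : ∀ n → facSum (suc n) + facSum (suc n) ≡ fromℕ (suc n !) + fromℕ (suc n !) + fromℕ (2 ℕ.+ n) * facSum n
facSum-rec n = begin
  facSum (suc n) + facSum (suc n) ≡⟨ cong₂ _+_ last first ⟩
  (A + F) + (F + B)               ≡⟨ solve 3 (λ a b c → (a :+ c) :+ (c :+ b) := c :+ c :+ (a :+ b)) refl A B F ⟩
  F + F + (A + B)                 ≡⟨ cong (λ z → F + F + z) A+B ⟩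
  F + F + fromℕ (2 ℕ.+ n) * facSum n ∎
  where
  open ≡-Reasoning
  open ℚSolver.+-*-Solver
  F = fromℕ (suc n !)
  g : ℕ → ℚ
  g k = fromℕ (k ! ℕ.* (suc n ∸ k) !)
  h : ℕ → ℚ
  h k = fromℕ (suc k ! ℕ.* (n ∸ k) !)
  A = ∑ (suc n) g
  B = ∑ (suc n) h
  last : facSum (suc n) ≡ A + F
  last = cong (λ z → A + z) (cong fromℕ (trans (cong (λ m → suc n ! ℕ.* m !) (ℕP.n∸n≡0 n)) (ℕP.*-identityʳ (suc n !))))
  first : facSum (suc n) ≡ F + B
  first = trans (∑-suc (suc n) g) (cong (_+ B) (cong fromℕ (ℕP.*-identityˡ (suc n !))))
  A+B : A + B ≡ fromℕ (2 ℕ.+ n) * facSum n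
  A+B = begin
    A + B                                                         ≡⟨ sym (∑-+ (suc n) g h) ⟩
    ∑ (suc n) (λ k → g k + h k)                                   ≡⟨ ∑-cong (suc n) (λ k k≤n → trans (sym (fromℕ-+ _ _))
                                                                     (trans (cong fromℕ (factorial-pascal n k (ℕP.≤-pred k≤n))) (fromℕ-* (2 ℕ.+ n) _))) ⟩
    ∑ (suc n) (λ k → fromℕ (2 ℕ.+ n) * fromℕ (k ! ℕ.* (n ∸ k) !)) ≡⟨ sym (∑-*ˡ (suc n) (fromℕ (2 ℕ.+ n)) _) ⟩
    fromℕ (2 ℕ.+ n) * facSum n                                    ∎

f-rec : ∀ n → f (suc n) + f (suc n) ≡ 1ℚ + 1ℚ + fromℕ (2 ℕ.+ n) * inv (suc n) * f n
f-rec n = begin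
  f (suc n) + f (suc n)       ≡⟨ cong₂ _+_ (f≡facSum*inv (suc n)) (f≡facSum*inv (suc n)) ⟩
  F₁ * I₁ + F₁ * I₁           ≡⟨ ≡-modulo (1ℚ + 1ℚ) (fromℕ*inv≡1 (suc n !)) (≡-modulo I₁ (facSum-rec n)
                                 (lem F₁ F₀ (fromℕ (suc n !)) w I₁)) ⟩
  1ℚ + 1ℚ + w * F₀ * I₁       ≡⟨ cong (λ z → 1ℚ + 1ℚ + w * F₀ * z) (inv-* (suc n) (n !)) ⟩
  1ℚ + 1ℚ + w * F₀ * (u * I₀) ≡⟨ solve 4 (λ w F u I → con 1ℚ :+ con 1ℚ :+ w :* F :* (u :* I) := con 1ℚ :+ con 1ℚ :+ w :* u :* (F :* I))
                                 refl w F₀ u I₀ ⟩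
  1ℚ + 1ℚ + w * u * (F₀ * I₀) ≡⟨ cong (λ z → 1ℚ + 1ℚ + w * u * z) (sym (f≡facSum*inv n)) ⟩
  1ℚ + 1ℚ + w * u * f n       ∎
  where
  open ≡-Reasoning
  open ℚSolver.+-*-Solver
  F₁ = facSum (suc n)
  F₀ = facSum n
  I₁ = inv (suc n !)
  I₀ = inv (n !)
  u = inv (suc n)
  w = fromℕ (2 ℕ.+ n)
  instance _ = suc n ℕP.!≢0
  lem : ∀ F₁ F₀ Fc w I → F₁ * I + F₁ * I
    ≡ 1ℚ + 1ℚ + w * F₀ * I + (1ℚ + 1ℚ) * (Fc * I - 1ℚ) + I * (F₁ + F₁ - (Fc + Fc + w * F₀))
  lem = solve 5 (λ F₁ F₀ Fc w I → F₁ :* I :+ F₁ :* I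
    := con 1ℚ :+ con 1ℚ :+ w :* F₀ :* I :+ (con 1ℚ :+ con 1ℚ) :* (Fc :* I :- con 1ℚ) :+ I :* (F₁ :+ F₁ :- (Fc :+ Fc :+ w :* F₀))) refl

σ : ℕ → ℚ
σ k = fromℕ (2 ^ suc k) * inv (suc k)

S : ℕ → ℚ
S m = ∑ m σ

F : ℕ → ℚ
F N = fromℕ N * inv (2 ^ N) * S N

two*inv2≡1 : (1ℚ + 1ℚ) * inv 2 ≡ 1ℚ
two*inv2≡1 = trans (cong (_* inv 2) (sym fromℕ-2)) (fromℕ*inv≡1 2)

F-rec : ∀ n → F (suc (suc n)) + F (suc (suc n)) ≡ 1ℚ + 1ℚ + fromℕ (2 ℕ.+ n) * inv (suc n) * F (suc n)
F-rec n = begin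
  F (suc (suc n)) + F (suc (suc n)) ≡⟨ cong₂ _+_ unfold unfold ⟩
  X + X                             ≡⟨ ≡-modulo (w * iP * s + (1ℚ + 1ℚ) * (w * iw) * (P * iP)) two*inv2≡1
                                       (≡-modulo (- (w * iP * s)) (fromℕ*inv≡1 (suc n))
                                       (≡-modulo ((1ℚ + 1ℚ) * (P * iP)) (fromℕ*inv≡1 (2 ℕ.+ n))
                                       (≡-modulo (1ℚ + 1ℚ) (fromℕ*inv≡1 (2 ^ suc n) {{ℕP.m^n≢0 2 (suc n)}})
                                       (lem w (inv 2) iP s P iw u iu)))) ⟩
  1ℚ + 1ℚ + w * iu * (u * iP * s)   ∎
  where
  open ≡-Reasoning
  open ℚSolver.+-*-Solver
  w = fromℕ (2 ℕ.+ n)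
  iw = inv (2 ℕ.+ n)
  u = fromℕ (suc n)
  iu = inv (suc n)
  P = fromℕ (2 ^ suc n)
  iP = inv (2 ^ suc n)
  s = S (suc n)
  X = w * (inv 2 * iP) * (s + ((1ℚ + 1ℚ) * P) * iw)
  unfold : F (suc (suc n)) ≡ X
  unfold = cong₂ (λ a b → w * a * (s + b * iw)) (inv-* 2 (2 ^ suc n))
    (trans (fromℕ-* 2 (2 ^ suc n)) (cong (_* P) fromℕ-2))
  lem : ∀ w h iP s P iw u iu →
    w * (h * iP) * (s + ((1ℚ + 1ℚ) * P) * iw) + w * (h * iP) * (s + ((1ℚ + 1ℚ) * P) * iw)
      ≡ 1ℚ + 1ℚ + w * iu * (u * iP * s)
        + (w * iP * s + (1ℚ + 1ℚ) * (w * iw) * (P * iP)) * ((1ℚ + 1ℚ) * h - 1ℚ)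
        + (- (w * iP * s)) * (u * iu - 1ℚ)
        + ((1ℚ + 1ℚ) * (P * iP)) * (w * iw - 1ℚ)
        + (1ℚ + 1ℚ) * (P * iP - 1ℚ)
  lem = solve 8 (λ w h iP s P iw u iu →
    w :* (h :* iP) :* (s :+ ((con 1ℚ :+ con 1ℚ) :* P) :* iw) :+ w :* (h :* iP) :* (s :+ ((con 1ℚ :+ con 1ℚ) :* P) :* iw)
      := con 1ℚ :+ con 1ℚ :+ w :* iu :* (u :* iP :* s)
        :+ (w :* iP :* s :+ (con 1ℚ :+ con 1ℚ) :* (w :* iw) :* (P :* iP)) :* ((con 1ℚ :+ con 1ℚ) :* h :- con 1ℚ)
        :+ (:- (w :* iP :* s)) :* (u :* iu :- con 1ℚ)
        :+ ((con 1ℚ :+ con 1ℚ) :* (P :* iP)) :* (w :* iw :- con 1ℚ)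
        :+ (con 1ℚ :+ con 1ℚ) :* (P :* iP :- con 1ℚ)) refl

f≡F : ∀ n → f n ≡ F (suc n)
f≡F zero = sym (begin
  fromℕ 1 * inv 2 * (0ℚ + fromℕ 2 * inv 1) ≡⟨ cong₂ (λ a b → a * inv 2 * (0ℚ + fromℕ 2 * b)) fromℕ-1 inv-1 ⟩
  1ℚ * inv 2 * (0ℚ + fromℕ 2 * 1ℚ)         ≡⟨ cong (λ a → 1ℚ * inv 2 * (0ℚ + a * 1ℚ)) fromℕ-2 ⟩
  1ℚ * inv 2 * (0ℚ + (1ℚ + 1ℚ) * 1ℚ)       ≡⟨ solve 1 (λ h → con 1ℚ :* h :* (con 0ℚ :+ (con 1ℚ :+ con 1ℚ) :* con 1ℚ)
                                                   := (con 1ℚ :+ con 1ℚ) :* h) refl (inv 2) ⟩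
  (1ℚ + 1ℚ) * inv 2                        ≡⟨ two*inv2≡1 ⟩
  1ℚ                                       ∎)
  where
  open ≡-Reasoning
  open ℚSolver.+-*-Solver
f≡F (suc n) = double-injective (begin
  f (suc n) + f (suc n)                               ≡⟨ f-rec n ⟩
  1ℚ + 1ℚ + fromℕ (2 ℕ.+ n) * inv (suc n) * f n       ≡⟨ cong (λ z → 1ℚ + 1ℚ + fromℕ (2 ℕ.+ n) * inv (suc n) * z) (f≡F n) ⟩
  1ℚ + 1ℚ + fromℕ (2 ℕ.+ n) * inv (suc n) * F (suc n) ≡⟨ sym (F-rec n) ⟩
  F (suc (suc n)) + F (suc (suc n))                   ∎)
  where open ≡-Reasoning

-- S as a sum of reciprocal binomial coefficients

-- invC N i = i! N! / (N + i)! = 1 / C(N + i, i)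
invC : ℕ → ℕ → ℚ
invC N zero = 1ℚ
invC N (suc i) = invC N i * fromℕ (suc i) * inv (suc (N ℕ.+ i))

binomTerm : ℕ → ℕ → ℚ
binomTerm N i = fromℕ (2 ^ suc (N ℕ.+ i)) * invC N i * inv (suc (N ℕ.+ i))

T : ℕ → ℚ
T N = ∑ N (binomTerm N)

invC-suc : ∀ N i → invC (suc N) i ≡ invC N i * fromℕ (suc N) * inv (suc (N ℕ.+ i))
invC-suc N zero = sym (begin
  1ℚ * fromℕ (suc N) * inv (suc (N ℕ.+ 0)) ≡⟨ cong (λ m → 1ℚ * fromℕ (suc N) * inv (suc m)) (ℕP.+-identityʳ N) ⟩
  1ℚ * fromℕ (suc N) * inv (suc N)         ≡⟨ trans (ℚP.*-assoc 1ℚ (fromℕ (suc N)) (inv (suc N))) (ℚP.*-identityˡ _) ⟩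
  fromℕ (suc N) * inv (suc N)              ≡⟨ fromℕ*inv≡1 (suc N) ⟩
  1ℚ                                       ∎)
  where open ≡-Reasoning
invC-suc N (suc i) = begin
  invC (suc N) i * fromℕ (suc i) * inv (suc (suc N ℕ.+ i))  ≡⟨ cong (λ z → z * fromℕ (suc i) * inv (suc (suc N ℕ.+ i))) (invC-suc N i) ⟩
  invC N i * fromℕ (suc N) * inv (suc (N ℕ.+ i)) * fromℕ (suc i) * inv (suc (suc N ℕ.+ i))
    ≡⟨ solve 5 (λ a b c d e → a :* b :* c :* d :* e := a :* d :* c :* b :* e) refl
         (invC N i) (fromℕ (suc N)) (inv (suc (N ℕ.+ i))) (fromℕ (suc i)) (inv (suc (suc N ℕ.+ i))) ⟩
  invC N i * fromℕ (suc i) * inv (suc (N ℕ.+ i)) * fromℕ (suc N) * inv (suc (suc N ℕ.+ i))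
    ≡⟨ cong (λ m → invC N i * fromℕ (suc i) * inv (suc (N ℕ.+ i)) * fromℕ (suc N) * inv (suc m)) (sym (ℕP.+-suc N i)) ⟩
  invC N (suc i) * fromℕ (suc N) * inv (suc (N ℕ.+ suc i)) ∎
  where
  open ≡-Reasoning
  open ℚSolver.+-*-Solver

fromℕ-2^suc : ∀ n → fromℕ (2 ^ suc n) ≡ (1ℚ + 1ℚ) * fromℕ (2 ^ n)
fromℕ-2^suc n = trans (fromℕ-* 2 (2 ^ n)) (cong (_* fromℕ (2 ^ n)) fromℕ-2)

binomTerm-pascal : ∀ N i → binomTerm (suc N) i + binomTerm N (suc i) ≡ (1ℚ + 1ℚ) * binomTerm N i
binomTerm-pascal N i = begin
  binomTerm (suc N) i + binomTerm N (suc i)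
    ≡⟨ cong₂ _+_ (cong (λ z → X₂ * z * iB) (invC-suc N i))
         (cong (λ m → fromℕ (2 ^ suc m) * (K * fromℕ (suc i) * iA) * inv (suc m)) (ℕP.+-suc N i)) ⟩
  X₂ * (K * sN * iA) * iB + X₂ * (K * si * iA) * iB
    ≡⟨ solve 6 (λ X₂ K sN si iA iB → X₂ :* (K :* sN :* iA) :* iB :+ X₂ :* (K :* si :* iA) :* iB
                   := X₂ :* K :* iA :* ((sN :+ si) :* iB)) refl X₂ K sN si iA iB ⟩
  X₂ * K * iA * ((sN + si) * iB)
    ≡⟨ cong (λ z → X₂ * K * iA * (z * iB)) (trans (sym (fromℕ-+ (suc N) (suc i))) (cong (fromℕ ∘ suc) (ℕP.+-suc N i))) ⟩
  X₂ * K * iA * (fromℕ (suc (suc (N ℕ.+ i))) * iB)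
    ≡⟨ cong (X₂ * K * iA *_) (fromℕ*inv≡1 (suc (suc (N ℕ.+ i)))) ⟩
  X₂ * K * iA * 1ℚ
    ≡⟨ cong (λ z → z * K * iA * 1ℚ) (fromℕ-2^suc (suc (N ℕ.+ i))) ⟩
  (1ℚ + 1ℚ) * X₁ * K * iA * 1ℚ
    ≡⟨ solve 3 (λ X₁ K iA → (con 1ℚ :+ con 1ℚ) :* X₁ :* K :* iA :* con 1ℚ := (con 1ℚ :+ con 1ℚ) :* (X₁ :* K :* iA)) refl X₁ K iA ⟩
  (1ℚ + 1ℚ) * binomTerm N i ∎
  where
  open ≡-Reasoning
  open ℚSolver.+-*-Solver
  X₁ = fromℕ (2 ^ suc (N ℕ.+ i))
  X₂ = fromℕ (2 ^ suc (suc (N ℕ.+ i)))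
  K = invC N i
  sN = fromℕ (suc N)
  si = fromℕ (suc i)
  iA = inv (suc (N ℕ.+ i))
  iB = inv (suc (suc (N ℕ.+ i)))

binomTerm-last : ∀ N → binomTerm N (suc N) ≡ binomTerm N N
binomTerm-last N = begin
  fromℕ (2 ^ suc (N ℕ.+ suc N)) * (K * fromℕ (suc N) * iA) * inv (suc (N ℕ.+ suc N))
    ≡⟨ cong (λ m → fromℕ (2 ^ suc m) * (K * fromℕ (suc N) * iA) * inv (suc m)) (ℕP.+-suc N N) ⟩
  fromℕ (2 ^ suc (suc (N ℕ.+ N))) * (K * fromℕ (suc N) * iA) * iB
    ≡⟨ cong (λ z → z * (K * fromℕ (suc N) * iA) * iB) (fromℕ-2^suc (suc (N ℕ.+ N))) ⟩
  (1ℚ + 1ℚ) * X * (K * fromℕ (suc N) * iA) * iB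
    ≡⟨ solve 5 (λ X K s iA iB → (con 1ℚ :+ con 1ℚ) :* X :* (K :* s :* iA) :* iB
                   := X :* K :* iA :* (((con 1ℚ :+ con 1ℚ) :* s) :* iB)) refl X K (fromℕ (suc N)) iA iB ⟩
  X * K * iA * (((1ℚ + 1ℚ) * fromℕ (suc N)) * iB)
    ≡⟨ cong (λ z → X * K * iA * (z * iB)) double ⟩
  X * K * iA * (fromℕ (suc (suc (N ℕ.+ N))) * iB)
    ≡⟨ cong (X * K * iA *_) (fromℕ*inv≡1 (suc (suc (N ℕ.+ N)))) ⟩
  X * K * iA * 1ℚ
    ≡⟨ ℚP.*-identityʳ _ ⟩
  binomTerm N N ∎
  where
  open ≡-Reasoning
  open ℚSolver.+-*-Solver
  X = fromℕ (2 ^ suc (N ℕ.+ N))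
  K = invC N N
  iA = inv (suc (N ℕ.+ N))
  iB = inv (suc (suc (N ℕ.+ N)))
  double : (1ℚ + 1ℚ) * fromℕ (suc N) ≡ fromℕ (suc (suc (N ℕ.+ N)))
  double = trans (cong (_* fromℕ (suc N)) (sym fromℕ-2)) (trans (sym (fromℕ-* 2 (suc N)))
    (cong (fromℕ ∘ suc) (trans (ℕP.+-suc N (N ℕ.+ 0)) (cong (suc ∘ (N ℕ.+_)) (ℕP.+-identityʳ N)))))

binomTerm-first : ∀ N → binomTerm N 0 ≡ fromℕ (2 ^ suc N) * inv (suc N)
binomTerm-first N = trans (cong (λ m → fromℕ (2 ^ suc m) * 1ℚ * inv (suc m)) (ℕP.+-identityʳ N))
  (cong (_* inv (suc N)) (ℚP.*-identityʳ (fromℕ (2 ^ suc N))))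

T-suc : ∀ N → T (suc N) ≡ T N + fromℕ (2 ^ suc N) * inv (suc N)
T-suc N = begin
  ∑ (suc N) (binomTerm (suc N))                 ≡⟨ ∑-cong (suc N) (λ i _ → move (binomTerm-pascal N i)) ⟩
  ∑ (suc N) (λ i → (1ℚ + 1ℚ) * t i - t (suc i)) ≡⟨ ∑-- (suc N) _ (t ∘ suc) ⟩
  ∑ (suc N) (λ i → (1ℚ + 1ℚ) * t i) - R         ≡⟨ cong (_- R) (sym (∑-*ˡ (suc N) (1ℚ + 1ℚ) t)) ⟩
  (1ℚ + 1ℚ) * (T N + t N) - R                   ≡⟨ ≡-modulo (- 1ℚ) (binomTerm-last N) (≡-modulo (- 1ℚ) (sym (∑-suc (suc N) t))
                                                   (lem (T N) (t N) (t (suc N)) R (t 0))) ⟩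
  T N + t 0                                     ≡⟨ cong (λ z → T N + z) (binomTerm-first N) ⟩
  T N + fromℕ (2 ^ suc N) * inv (suc N)         ∎
  where
  open ≡-Reasoning
  open ℚSolver.+-*-Solver
  t = binomTerm N
  R = ∑ (suc N) (t ∘ suc)
  move : ∀ {x y z} → x + y ≡ z → x ≡ z - y
  move {x} {y} refl = solve 2 (λ x y → x := x :+ y :- y) refl x y
  lem : ∀ A tN tN₁ R t₀ → (1ℚ + 1ℚ) * (A + tN) - R
    ≡ A + t₀ + (- 1ℚ) * (tN₁ - tN) + (- 1ℚ) * ((t₀ + R) - (A + tN + tN₁))
  lem = solve 5 (λ A tN tN₁ R t₀ → (con 1ℚ :+ con 1ℚ) :* (A :+ tN) :- R
    := A :+ t₀ :+ (:- con 1ℚ) :* (tN₁ :- tN) :+ (:- con 1ℚ) :* ((t₀ :+ R) :- (A :+ tN :+ tN₁))) refl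

S≡T : ∀ N → S N ≡ T N
S≡T zero = refl
S≡T (suc N) = trans (cong (_+ fromℕ (2 ^ suc N) * inv (suc N)) (S≡T N)) (sym (T-suc N))

-- The case p = 2

module _ (M : ℕ) where

  private
    N = 2 ^ M
    1<2 : 1 < 2
    1<2 = s≤s (s≤s z≤n)

  -- v₂(2^M + j) ≤ j for 1 ≤ j ≤ 2^M: it is v₂(j) for j < 2^M, and M + 1 for j = 2^M.
  PPart-2^M+ : ∀ i → i < N → Σ (PPart 2 (N ℕ.+ suc i)) (λ d → exp d ≤ suc i)
  PPart-2^M+ i i<N with ℕP.m≤n⇒m<n∨m≡n i<N
  ... | inj₁ 1+i<N = d′ , ℕP.<⇒≤ (exp<J 1<2 d)
    where
    d = toPPart 1<2 (suc i) (s≤s z≤n)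
    d′ = PPart-p^+ 1<2 M d (exp< 1<2 d 1+i<N)
  ... | inj₂ 1+i≡N = pPart (suc M) 1 N+N≡ (p∤1 prime[2]) , subst (suc M ≤_) (sym 1+i≡N) (n<p^n 1<2 M)
    where
    N+N≡ : N ℕ.+ suc i ≡ 2 ^ suc M ℕ.* 1
    N+N≡ = trans (cong (N ℕ.+_) (trans 1+i≡N (sym (ℕP.+-identityʳ N)))) (sym (ℕP.*-identityʳ (2 ^ suc M)))

  invC-unit : ∀ i → i < N → Val≥ 2 0 (invC N i)
  invC-unit zero _ = subst (Val≥ 2 0) fromℕ-1 (Val≥-fromℕ prime[2] 1)
  invC-unit (suc i) 1+i<N = subst (Val≥ 2 0) (sym (ℚP.*-assoc (invC N i) (fromℕ (suc i)) _))
    (Val≥-* prime[2] (invC-unit i (ℕP.<-trans (ℕP.n<1+n i) 1+i<N))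
      (subst (λ K → Val≥ 2 0 (fromℕ (suc i) * inv K)) (ℕP.+-suc N i) (Val≥-/p^+ prime[2] M d t<M)))
    where
    d = toPPart 1<2 (suc i) (s≤s z≤n)
    t<M = exp< 1<2 d 1+i<N

  weightedTerm : ∀ i → fromℕ N * inv (2 ^ N) * binomTerm N i ≡ fromℕ N * (fromℕ (2 ^ suc i) * inv (N ℕ.+ suc i)) * invC N i
  weightedTerm i = begin
    n * iP * (fromℕ (2 ^ suc (N ℕ.+ i)) * K * inv (suc (N ℕ.+ i)))
      ≡⟨ cong (λ m → n * iP * (fromℕ (2 ^ m) * K * inv m)) (sym (ℕP.+-suc N i)) ⟩
    n * iP * (fromℕ (2 ^ (N ℕ.+ suc i)) * K * I)
      ≡⟨ cong (λ z → n * iP * (z * K * I)) (trans (cong fromℕ (ℕP.^-distribˡ-+-* 2 N (suc i))) (fromℕ-* (2 ^ N) (2 ^ suc i))) ⟩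
    n * iP * (P * X * K * I)
      ≡⟨ ≡-modulo (n * X * K * I) (fromℕ*inv≡1 (2 ^ N) {{ℕP.m^n≢0 2 N}})
           (solve 6 (λ n iP P X K I → n :* iP :* (P :* X :* K :* I) := n :* (X :* I) :* K :+ n :* X :* K :* I :* (P :* iP :- con 1ℚ))
             refl n iP P X K I) ⟩
    n * (X * I) * K ∎
    where
    open ≡-Reasoning
    open ℚSolver.+-*-Solver
    n = fromℕ N
    iP = inv (2 ^ N)
    P = fromℕ (2 ^ N)
    X = fromℕ (2 ^ suc i)
    K = invC N i
    I = inv (N ℕ.+ suc i)

  weightedTerm-Val≥ : ∀ i → i < N → Val≥ 2 M (fromℕ N * inv (2 ^ N) * binomTerm N i)
  weightedTerm-Val≥ i i<N with PPart-2^M+ i i<N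
  ... | d , t≤1+i = subst (Val≥ 2 M) (sym (weightedTerm i))
    (Val≥-*-unit prime[2] (Val≥-*-unit prime[2] (Val≥-p^ prime[2] M) (Val≥-weaken prime[2] z≤n (Val≥-p^/ prime[2] (suc i) d t≤1+i)))
      (invC-unit i i<N))

F-2^-Val≥ : ∀ M → Val≥ 2 M (F (2 ^ M))
F-2^-Val≥ M = subst (Val≥ 2 M) (sym F≡∑) (Val≥-∑ prime[2] (2 ^ M) _ (weightedTerm-Val≥ M))
  where
  F≡∑ : F (2 ^ M) ≡ ∑ (2 ^ M) (λ i → fromℕ (2 ^ M) * inv (2 ^ 2 ^ M) * binomTerm (2 ^ M) i)
  F≡∑ = trans (cong (fromℕ (2 ^ M) * inv (2 ^ 2 ^ M) *_) (S≡T (2 ^ M))) (∑-*ˡ (2 ^ M) (fromℕ (2 ^ M) * inv (2 ^ 2 ^ M)) (binomTerm (2 ^ M)))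

-- Fermat's little theorem for the base 2, lifted to prime powers

∑ℕ : ℕ → (ℕ → ℕ) → ℕ
∑ℕ zero g = 0
∑ℕ (suc n) g = ∑ℕ n g ℕ.+ g n

∑ℕ-suc : ∀ n g → ∑ℕ (suc n) g ≡ g 0 ℕ.+ ∑ℕ n (λ k → g (suc k))
∑ℕ-suc zero g = ℕP.+-comm 0 (g 0)
∑ℕ-suc (suc n) g = trans (cong (ℕ._+ g (suc n)) (∑ℕ-suc n g)) (ℕP.+-assoc (g 0) _ (g (suc n)))

∑ℕ-+ : ∀ n g h → ∑ℕ n (λ i → g i ℕ.+ h i) ≡ ∑ℕ n g ℕ.+ ∑ℕ n h
∑ℕ-+ zero g h = refl
∑ℕ-+ (suc n) g h = trans (cong (ℕ._+ (g n ℕ.+ h n)) (∑ℕ-+ n g h))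
  (solve 4 (λ a b c d → a :+ b :+ (c :+ d) := a :+ c :+ (b :+ d)) refl (∑ℕ n g) (∑ℕ n h) (g n) (h n))
  where open ℕSolver.+-*-Solver

∑ℕ-cong : ∀ n {g h} → (∀ i → i < n → g i ≡ h i) → ∑ℕ n g ≡ ∑ℕ n h
∑ℕ-cong zero eq = refl
∑ℕ-cong (suc n) eq = cong₂ ℕ._+_ (∑ℕ-cong n (λ i i<n → eq i (ℕP.m<n⇒m<1+n i<n))) (eq n ℕP.≤-refl)

∣-∑ℕ : ∀ {d} n g → (∀ i → i < n → d ∣ g i) → d ∣ ∑ℕ n g
∣-∑ℕ zero g _ = _ ∣.∣0
∣-∑ℕ (suc n) g d∣ = ∣.∣m∣n⇒∣m+n (∣-∑ℕ n g (λ i i<n → d∣ i (ℕP.m<n⇒m<1+n i<n))) (d∣ n ℕP.≤-refl)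

∑binomial≡2^ : ∀ n → ∑ℕ (suc n) (n C_) ≡ 2 ^ n
∑binomial≡2^ zero = refl
∑binomial≡2^ (suc n) = begin
  ∑ℕ (suc (suc n)) (suc n C_)                  ≡⟨ ∑ℕ-suc (suc n) (suc n C_) ⟩
  1 ℕ.+ ∑ℕ (suc n) (λ k → suc n C suc k)       ≡⟨ cong (1 ℕ.+_) (∑ℕ-cong (suc n) (λ k _ → sym (nCk+nC[k+1]≡[n+1]C[k+1] n k))) ⟩
  1 ℕ.+ ∑ℕ (suc n) (λ k → n C k ℕ.+ n C suc k) ≡⟨ cong (1 ℕ.+_) (∑ℕ-+ (suc n) (n C_) (λ k → n C suc k)) ⟩
  1 ℕ.+ (A ℕ.+ B)                              ≡⟨ solve 2 (λ a b → con 1 :+ (a :+ b) := a :+ (con 1 :+ b)) refl A B ⟩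
  A ℕ.+ (1 ℕ.+ B)                              ≡⟨ cong (A ℕ.+_) 1+B≡A ⟩
  A ℕ.+ A                                      ≡⟨ cong (λ z → z ℕ.+ z) (∑binomial≡2^ n) ⟩
  2 ^ n ℕ.+ 2 ^ n                              ≡⟨ cong (2 ^ n ℕ.+_) (sym (ℕP.+-identityʳ (2 ^ n))) ⟩
  2 ^ suc n                                    ∎
  where
  open ≡-Reasoning
  open ℕSolver.+-*-Solver
  A = ∑ℕ (suc n) (n C_)
  B = ∑ℕ (suc n) (λ k → n C suc k)
  1+B≡A : 1 ℕ.+ B ≡ A
  1+B≡A = trans (sym (∑ℕ-suc (suc n) (n C_))) (trans (cong (A ℕ.+_) (k>n⇒nCk≡0 (ℕP.n<1+n n))) (ℕP.+-identityʳ A))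

geomSum : ℕ → ℕ → ℕ
geomSum x n = ∑ℕ n (x ^_)

^≡1+*geomSum : ∀ {x d} n → x ≡ 1 ℕ.+ d → x ^ n ≡ 1 ℕ.+ d ℕ.* geomSum x n
^≡1+*geomSum {x} {d} zero _ = cong (1 ℕ.+_) (sym (ℕP.*-zeroʳ d))
^≡1+*geomSum {x} {d} (suc n) x≡ = begin
  x ℕ.* x ^ n                         ≡⟨ cong₂ ℕ._*_ x≡ (^≡1+*geomSum n x≡) ⟩
  (1 ℕ.+ d) ℕ.* (1 ℕ.+ d ℕ.* G)       ≡⟨ solve 2 (λ d g → (con 1 :+ d) :* (con 1 :+ d :* g) := con 1 :+ d :* (g :+ (con 1 :+ d :* g))) refl d G ⟩
  1 ℕ.+ d ℕ.* (G ℕ.+ (1 ℕ.+ d ℕ.* G)) ≡⟨ cong (λ z → 1 ℕ.+ d ℕ.* (G ℕ.+ z)) (sym (^≡1+*geomSum n x≡)) ⟩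
  1 ℕ.+ d ℕ.* geomSum x (suc n)       ∎
  where
  open ≡-Reasoning
  open ℕSolver.+-*-Solver
  G = geomSum x n

geomSum≡n+p* : ∀ p {x c} n → x ≡ 1 ℕ.+ p ℕ.* c → ∃ λ h → geomSum x n ≡ n ℕ.+ p ℕ.* h
geomSum≡n+p* p zero _ = 0 , sym (ℕP.*-zeroʳ p)
geomSum≡n+p* p {x} {c} (suc n) x≡ with geomSum≡n+p* p n x≡
... | h , G≡ = h ℕ.+ c ℕ.* geomSum x n , (begin
  geomSum x n ℕ.+ x ^ n                             ≡⟨ cong₂ ℕ._+_ G≡ (^≡1+*geomSum n x≡) ⟩
  n ℕ.+ p ℕ.* h ℕ.+ (1 ℕ.+ p ℕ.* c ℕ.* geomSum x n) ≡⟨ solve 5 (λ n p h c g → n :+ p :* h :+ (con 1 :+ p :* c :* g) := con 1 :+ n :+ p :* (h :+ c :* g))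
                                                       refl n p h c (geomSum x n) ⟩
  suc n ℕ.+ p ℕ.* (h ℕ.+ c ℕ.* geomSum x n)         ∎)
  where
  open ≡-Reasoning
  open ℕSolver.+-*-Solver

-- x^p - 1 = (x - 1)(1 + x + ... + x^(p-1)), and the second factor is ≡ p ≡ 0 (mod p).
^p-lift : ∀ p {x c} e → x ≡ 1 ℕ.+ p ^ suc e ℕ.* c → ∃ λ c′ → x ^ p ≡ 1 ℕ.+ p ^ suc (suc e) ℕ.* c′
^p-lift p {x} {c} e x≡ with geomSum≡n+p* p p (trans x≡ (cong (1 ℕ.+_) (ℕP.*-assoc p (p ^ e) c)))
... | h , G≡ = c ℕ.* (1 ℕ.+ h) , (begin
  x ^ p                                       ≡⟨ ^≡1+*geomSum p x≡ ⟩
  1 ℕ.+ p ^ suc e ℕ.* c ℕ.* geomSum x p       ≡⟨ cong (λ z → 1 ℕ.+ p ^ suc e ℕ.* c ℕ.* z) G≡ ⟩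
  1 ℕ.+ p ℕ.* p ^ e ℕ.* c ℕ.* (p ℕ.+ p ℕ.* h) ≡⟨ solve 4 (λ p q c h → con 1 :+ p :* q :* c :* (p :+ p :* h) := con 1 :+ p :* (p :* q) :* (c :* (con 1 :+ h)))
                                                 refl p (p ^ e) c h ⟩
  1 ℕ.+ p ^ suc (suc e) ℕ.* (c ℕ.* (1 ℕ.+ h)) ∎)
  where
  open ℕSolver.+-*-Solver
  open ≡-Reasoning

^p^t-lift : ∀ p {x c} t → x ≡ 1 ℕ.+ p ℕ.* c → ∃ λ c′ → x ^ (p ^ t) ≡ 1 ℕ.+ p ^ suc t ℕ.* c′
^p^t-lift p {x} {c} zero x≡ = c , trans (ℕP.*-identityʳ x) (trans x≡ (cong (λ z → 1 ℕ.+ z ℕ.* c) (sym (ℕP.*-identityʳ p))))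
^p^t-lift p {x} (suc t) x≡ with ^p^t-lift p t x≡
... | c , ≡1+ with ^p-lift p t ≡1+
... | c′ , ≡1+′ = c′ , trans (cong (x ^_) (ℕP.*-comm p (p ^ t))) (trans (sym (ℕP.^-*-assoc x (p ^ t) p)) ≡1+′)

^p^t*-lift : ∀ p {x c} t w → x ≡ 1 ℕ.+ p ℕ.* c → ∃ λ e → x ^ (p ^ t ℕ.* w) ≡ 1 ℕ.+ p ^ suc t ℕ.* e
^p^t*-lift p {x} t w x≡ with ^p^t-lift p t x≡
... | c , ≡1+ = c ℕ.* geomSum (x ^ (p ^ t)) w , trans (sym (ℕP.^-*-assoc x (p ^ t) w))
  (trans (^≡1+*geomSum w ≡1+) (cong (1 ℕ.+_) (ℕP.*-assoc (p ^ suc t) c _)))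

module _ {p : ℕ} (pp : Prime p) where

  private
    1<p : 1 < p
    1<p = ℕ.nonTrivial⇒n>1 p {{prime⇒nonTrivial pp}}
    1+[p∸1]≡p : suc (p ∸ 1) ≡ p
    1+[p∸1]≡p = trans (ℕP.+-comm 1 (p ∸ 1)) (ℕP.m∸n+n≡m {p} {1} (ℕP.<⇒≤ 1<p))

  p∤k! : ∀ k → k < p → ¬ p ∣ k !
  p∤k! zero _ p∣1 = ℕP.<⇒≱ 1<p (∣.∣⇒≤ p∣1)
  p∤k! (suc k) 1+k<p p∣ with euclidsLemma (suc k) (k !) pp p∣
  ... | inj₁ p∣1+k = ℕP.<⇒≱ 1+k<p (∣.∣⇒≤ p∣1+k)
  ... | inj₂ p∣k! = p∤k! k (ℕP.<-trans (ℕP.n<1+n k) 1+k<p) p∣k!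

  p∣pCk : ∀ k → 0 < k → k < p → p ∣ p C k
  p∣pCk k 0<k k<p with euclidsLemma (p C k) (k ! ℕ.* (p ∸ k) !) pp p∣product
    where
    p∣product : p ∣ (p C k) ℕ.* (k ! ℕ.* (p ∸ k) !)
    p∣product = subst (p ∣_) (sym (nCk*k![n∸k]!≡n! (ℕP.<⇒≤ k<p))) (subst (λ q → q ∣ q !) 1+[p∸1]≡p (∣.m∣m*n ((p ∸ 1) !)))
  ... | inj₁ p∣C = p∣C
  ... | inj₂ p∣k![p∸k]! with euclidsLemma (k !) ((p ∸ k) !) pp p∣k![p∸k]!
  ...   | inj₁ p∣k! = ⊥-elim (p∤k! k k<p p∣k!)
  ...   | inj₂ p∣[p∸k]! = ⊥-elim (p∤k! (p ∸ k) (ℕP.∸-monoʳ-< {p} {k} {0} 0<k (ℕP.<⇒≤ k<p)) p∣[p∸k]!)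

  2^p≡2+p* : ∃ λ c → 2 ^ p ≡ 2 ℕ.+ p ℕ.* c
  2^p≡2+p* with ∣-∑ℕ {p} (p ∸ 1) (λ k → p C suc k)
                  (λ k k<p∸1 → p∣pCk (suc k) (s≤s z≤n) (subst (suc k <_) 1+[p∸1]≡p (s≤s k<p∸1)))
  ... | divides c middle≡ = c , (begin
    2 ^ p                                                    ≡⟨ sym (∑binomial≡2^ p) ⟩
    ∑ℕ (suc p) (p C_)                                        ≡⟨ ∑ℕ-suc p (p C_) ⟩
    1 ℕ.+ ∑ℕ p (λ k → p C suc k)                             ≡⟨ cong (λ q → 1 ℕ.+ ∑ℕ q (λ k → p C suc k)) (sym 1+[p∸1]≡p) ⟩
    1 ℕ.+ (∑ℕ (p ∸ 1) (λ k → p C suc k) ℕ.+ p C suc (p ∸ 1)) ≡⟨ cong (λ q → 1 ℕ.+ (∑ℕ (p ∸ 1) (λ k → p C suc k) ℕ.+ p C q)) 1+[p∸1]≡p ⟩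
    1 ℕ.+ (∑ℕ (p ∸ 1) (λ k → p C suc k) ℕ.+ p C p)           ≡⟨ cong₂ (λ a b → 1 ℕ.+ (a ℕ.+ b)) middle≡ (nCn≡1 p) ⟩
    1 ℕ.+ (c ℕ.* p ℕ.+ 1)                                    ≡⟨ solve 2 (λ c p → con 1 :+ (c :* p :+ con 1) := con 2 :+ p :* c) refl c p ⟩
    2 ℕ.+ p ℕ.* c                                            ∎)
    where
    open ≡-Reasoning
    open ℕSolver.+-*-Solver

  fermat-2 : p ≢ 2 → ∃ λ c → 2 ^ (p ∸ 1) ≡ 1 ℕ.+ p ℕ.* c
  fermat-2 p≢2 = [ (λ p∣2 → ⊥-elim (p≢2 (ℕP.≤-antisym (∣.∣⇒≤ p∣2) 1<p))) , from-p∣ ]′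
    (euclidsLemma 2 (2 ^ (p ∸ 1) ∸ 1) pp (divides c₀ 2*[2^[p∸1]∸1]≡c₀*p))
    where
    open ≡-Reasoning
    c₀ = proj₁ 2^p≡2+p*
    2*[2^[p∸1]∸1]≡c₀*p : 2 ℕ.* (2 ^ (p ∸ 1) ∸ 1) ≡ c₀ ℕ.* p
    2*[2^[p∸1]∸1]≡c₀*p = begin
      2 ℕ.* (2 ^ (p ∸ 1) ∸ 1) ≡⟨ ℕP.*-distribˡ-∸ 2 (2 ^ (p ∸ 1)) 1 ⟩
      2 ^ suc (p ∸ 1) ∸ 2     ≡⟨ cong (λ q → 2 ^ q ∸ 2) 1+[p∸1]≡p ⟩
      2 ^ p ∸ 2               ≡⟨ cong (_∸ 2) (proj₂ 2^p≡2+p*) ⟩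
      2 ℕ.+ p ℕ.* c₀ ∸ 2      ≡⟨ ℕP.m+n∸m≡n 2 (p ℕ.* c₀) ⟩
      p ℕ.* c₀                ≡⟨ ℕP.*-comm p c₀ ⟩
      c₀ ℕ.* p                ∎
    from-p∣ : p ∣ 2 ^ (p ∸ 1) ∸ 1 → ∃ λ c → 2 ^ (p ∸ 1) ≡ 1 ℕ.+ p ℕ.* c
    from-p∣ (divides c ≡c*p) = c , (begin
      2 ^ (p ∸ 1)           ≡⟨ sym (ℕP.m∸n+n≡m {2 ^ (p ∸ 1)} {1} (ℕP.m^n>0 2 (p ∸ 1))) ⟩
      2 ^ (p ∸ 1) ∸ 1 ℕ.+ 1 ≡⟨ cong (ℕ._+ 1) ≡c*p ⟩
      c ℕ.* p ℕ.+ 1         ≡⟨ trans (ℕP.+-comm (c ℕ.* p) 1) (cong (1 ℕ.+_) (ℕP.*-comm c p)) ⟩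
      1 ℕ.+ p ℕ.* c         ∎)

-- The case of odd p

F-suc-1 : ∀ n → F (suc n) - 1ℚ ≡ ∑ n (λ k → inv (2 ^ suc n) * fromℕ (2 ^ suc k) * (fromℕ (suc n) * inv (suc k)))
F-suc-1 n = begin
  a * i * (S n + P * j) - 1ℚ ≡⟨ ≡-modulo 1ℚ (fromℕ*inv≡1 (2 ^ suc n) {{ℕP.m^n≢0 2 (suc n)}}) (≡-modulo (P * i) (fromℕ*inv≡1 (suc n))
                                (solve 5 (λ a i S P j → a :* i :* (S :+ P :* j) :- con 1ℚ
                                  := a :* i :* S :+ con 1ℚ :* (P :* i :- con 1ℚ) :+ (P :* i) :* (a :* j :- con 1ℚ)) refl a i (S n) P j)) ⟩
  a * i * S n                ≡⟨ ∑-*ˡ n (a * i) σ ⟩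
  ∑ n (λ k → a * i * σ k)    ≡⟨ ∑-cong n (λ k _ → solve 4 (λ a i x y → a :* i :* (x :* y) := i :* x :* (a :* y))
                                  refl a i (fromℕ (2 ^ suc k)) (inv (suc k))) ⟩
  ∑ n (λ k → i * fromℕ (2 ^ suc k) * (a * inv (suc k))) ∎
  where
  open ≡-Reasoning
  open ℚSolver.+-*-Solver
  a = fromℕ (suc n)
  i = inv (2 ^ suc n)
  P = fromℕ (2 ^ suc n)
  j = inv (suc n)

2^-cancel : ∀ X Y P Q → fromℕ X * inv (2 ^ (P ℕ.+ Q)) * (fromℕ (2 ^ P) * inv Y) ≡ fromℕ X * inv Y * inv (2 ^ Q)
2^-cancel X Y P Q = begin
  x * inv (2 ^ (P ℕ.+ Q)) * (a * y) ≡⟨ cong (λ z → x * z * (a * y)) (trans (cong inv (ℕP.^-distribˡ-+-* 2 P Q)) (inv-* (2 ^ P) (2 ^ Q))) ⟩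
  x * (ia * b) * (a * y)            ≡⟨ ≡-modulo (x * y * b) (fromℕ*inv≡1 (2 ^ P) {{ℕP.m^n≢0 2 P}})
                                       (solve 5 (λ x ia b a y → x :* (ia :* b) :* (a :* y) := x :* y :* b :+ x :* y :* b :* (a :* ia :- con 1ℚ))
                                         refl x ia b a y) ⟩
  x * y * b                         ∎
  where
  open ≡-Reasoning
  open ℚSolver.+-*-Solver
  x = fromℕ X
  y = inv Y
  a = fromℕ (2 ^ P)
  ia = inv (2 ^ P)
  b = inv (2 ^ Q)

module _ {p : ℕ} (pp : Prime p) (p≢2 : p ≢ 2) where

  private
    instance
      p≢0 : NonZero p
      p≢0 = prime⇒nonZero pp
    1<p : 1 < p
    1<p = ℕ.nonTrivial⇒n>1 p {{prime⇒nonTrivial pp}}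
    1+[p∸1]≡p : suc (p ∸ 1) ≡ p
    1+[p∸1]≡p = trans (ℕP.+-comm 1 (p ∸ 1)) (ℕP.m∸n+n≡m {p} {1} (ℕP.<⇒≤ 1<p))

  p∤2^ : ∀ k → ¬ p ∣ 2 ^ k
  p∤2^ zero = p∤1 pp
  p∤2^ (suc k) = p∤* pp (λ p∣2 → p≢2 (ℕP.≤-antisym (∣.∣⇒≤ p∣2) 1<p)) (p∤2^ k)

  Val≥-p^/< : ∀ M J → 0 < J → J < p ^ M → Val≥ p 1 (fromℕ (p ^ M) * inv J)
  Val≥-p^/< M J 0<J J<p^M = Val≥-weaken pp (ℕP.m<n⇒0<n∸m t<M) (Val≥-p^/ pp M d (ℕP.<⇒≤ t<M))
    where
    d = toPPart 1<p J 0<J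
    t<M = exp< 1<p d J<p^M

  F-p^-1-Val≥ : ∀ M → Val≥ p 1 (F (p ^ M) - 1ℚ)
  F-p^-1-Val≥ M = subst (λ N → Val≥ p 1 (F N - 1ℚ)) 1+n≡p^M (subst (Val≥ p 1) (sym (F-suc-1 n)) (Val≥-∑ pp n _ term-Val≥))
    where
    n = p ^ M ∸ 1
    1+n≡p^M : suc n ≡ p ^ M
    1+n≡p^M = trans (ℕP.+-comm 1 n) (ℕP.m∸n+n≡m {p ^ M} {1} (ℕP.m^n>0 p M))
    term-Val≥ : ∀ k → k < n → Val≥ p 1 (inv (2 ^ suc n) * fromℕ (2 ^ suc k) * (fromℕ (suc n) * inv (suc k)))
    term-Val≥ k k<n = Val≥-* pp (Val≥-*-unit pp (Val≥-inv pp (p∤2^ (suc n))) (Val≥-fromℕ pp (2 ^ suc k)))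
      (subst (λ N → Val≥ p 1 (fromℕ N * inv (suc k))) (sym 1+n≡p^M)
        (Val≥-p^/< M (suc k) (s≤s z≤n) (subst (suc k <_) 1+n≡p^M (s≤s k<n))))

  lastInBlock-Val≥ : ∀ M q → q < p ^ M →
    Val≥ p (suc M) (fromℕ (p ^ suc M) * inv (2 ^ (p ℕ.* p ^ M)) * (fromℕ (2 ^ (p ℕ.* suc q)) * inv (p ℕ.* suc q))
                    - fromℕ (p ^ M) * inv (2 ^ p ^ M) * σ q)
  lastInBlock-Val≥ M q q<N = subst (Val≥ p (suc M)) (sym difference≡)
    (subst (λ k → Val≥ p k (- (R * (fromℕ (p ^ suc t) * (fromℕ e * I))))) index≡
      (Val≥-neg pp (Val≥-* pp (Val≥-p^/ pp M d t≤M)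
        (Val≥-*-unit pp (Val≥-p^ pp (suc t)) (Val≥-*-unit pp (Val≥-fromℕ pp e) (Val≥-inv pp (p∤2^ (p ℕ.* D))))))))
    where
    open ≡-Reasoning
    open ℚSolver.+-*-Solver
    N = p ^ M
    j = suc q
    D = N ∸ j
    N≡j+D : N ≡ j ℕ.+ D
    N≡j+D = sym (ℕP.m+[n∸m]≡n q<N)
    d = toPPart 1<p j (s≤s z≤n)
    t = exp d
    t≤M : t ≤ M
    t≤M = ℕP.≤-pred (exp< 1<p d (ℕP.≤-<-trans q<N (ℕP.^-monoʳ-< p 1<p (ℕP.n<1+n M))))
    D≡ : D ≡ p ^ t ℕ.* (p ^ (M ∸ t) ∸ unit d)
    D≡ = trans (cong₂ _∸_ (^-split p t≤M) (J≡p^exp*unit d)) (sym (ℕP.*-distribˡ-∸ (p ^ t) (p ^ (M ∸ t)) (unit d)))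
    lift = ^p^t*-lift p t (p ^ (M ∸ t) ∸ unit d) (proj₂ (fermat-2 pp p≢2))
    e = proj₁ lift
    B = 1 ℕ.+ p ^ suc t ℕ.* e
    -- 2^(pD) = 2^D · (2^(p-1))^D, and Fermat lifts to (2^(p-1))^D ≡ 1 (mod p^(t+1)) as p^t ∣ D.
    2^pD≡ : 2 ^ D ℕ.* B ≡ 2 ^ (p ℕ.* D)
    2^pD≡ = begin
      2 ^ D ℕ.* B                   ≡⟨ cong (2 ^ D ℕ.*_) (sym (trans (cong ((2 ^ (p ∸ 1)) ^_) D≡) (proj₂ lift))) ⟩
      2 ^ D ℕ.* (2 ^ (p ∸ 1)) ^ D   ≡⟨ cong (2 ^ D ℕ.*_) (ℕP.^-*-assoc 2 (p ∸ 1) D) ⟩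
      2 ^ D ℕ.* 2 ^ ((p ∸ 1) ℕ.* D) ≡⟨ sym (ℕP.^-distribˡ-+-* 2 D ((p ∸ 1) ℕ.* D)) ⟩
      2 ^ (suc (p ∸ 1) ℕ.* D)       ≡⟨ cong (λ m → 2 ^ (m ℕ.* D)) 1+[p∸1]≡p ⟩
      2 ^ (p ℕ.* D)                 ∎
    R = fromℕ N * inv j
    I = inv (2 ^ (p ℕ.* D))
    X = fromℕ (p ^ suc M) * inv (2 ^ (p ℕ.* N)) * (fromℕ (2 ^ (p ℕ.* j)) * inv (p ℕ.* j))
    Y = fromℕ N * inv (2 ^ N) * σ q
    first≡ : X ≡ R * I
    first≡ = begin
      fromℕ (p ℕ.* N) * inv (2 ^ (p ℕ.* N)) * (fromℕ (2 ^ (p ℕ.* j)) * inv (p ℕ.* j))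
        ≡⟨ cong (λ m → fromℕ (p ℕ.* N) * inv (2 ^ m) * (fromℕ (2 ^ (p ℕ.* j)) * inv (p ℕ.* j)))
             (trans (cong (p ℕ.*_) N≡j+D) (ℕP.*-distribˡ-+ p j D)) ⟩
      fromℕ (p ℕ.* N) * inv (2 ^ (p ℕ.* j ℕ.+ p ℕ.* D)) * (fromℕ (2 ^ (p ℕ.* j)) * inv (p ℕ.* j))
        ≡⟨ 2^-cancel (p ℕ.* N) (p ℕ.* j) (p ℕ.* j) (p ℕ.* D) ⟩
      fromℕ (p ℕ.* N) * inv (p ℕ.* j) * I
        ≡⟨ cong (_* I) (fraction-cancelˡ p N j) ⟩
      R * I ∎
    second≡ : Y ≡ R * (fromℕ B * I)
    second≡ = begin
      fromℕ N * inv (2 ^ N) * σ q         ≡⟨ cong (λ m → fromℕ N * inv (2 ^ m) * σ q) N≡j+D ⟩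
      fromℕ N * inv (2 ^ (j ℕ.+ D)) * σ q ≡⟨ 2^-cancel N j j D ⟩
      R * inv (2 ^ D)                     ≡⟨ cong (R *_) (inv-factor {{ℕP.m^n≢0 2 (p ℕ.* D)}} 2^pD≡) ⟩
      R * (fromℕ B * I)                   ∎
    difference≡ : X - Y ≡ - (R * (fromℕ (p ^ suc t) * (fromℕ e * I)))
    difference≡ = begin
      X - Y                                                ≡⟨ cong₂ _-_ first≡ second≡ ⟩
      R * I - R * (fromℕ B * I)                            ≡⟨ cong (λ z → R * I - R * (z * I))
                                                                (trans (fromℕ-+ 1 _) (cong₂ _+_ fromℕ-1 (fromℕ-* (p ^ suc t) e))) ⟩
      R * I - R * ((1ℚ + fromℕ (p ^ suc t) * fromℕ e) * I) ≡⟨ solve 4 (λ R I P e → R :* I :- R :* ((con 1ℚ :+ P :* e) :* I) := :- (R :* (P :* (e :* I))))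
                                                              refl R I (fromℕ (p ^ suc t)) (fromℕ e) ⟩
      - (R * (fromℕ (p ^ suc t) * (fromℕ e * I)))          ∎
    index≡ : M ∸ t ℕ.+ suc t ≡ suc M
    index≡ = trans (ℕP.+-suc (M ∸ t) t) (cong suc (ℕP.m∸n+n≡m t≤M))

  F-p^-difference-Val≥ : ∀ M → Val≥ p (suc M) (F (p ^ suc M) - F (p ^ M))
  F-p^-difference-Val≥ M = subst (Val≥ p (suc M)) (sym F-F≡∑) (Val≥-∑ pp N _ λ q q<N →
    subst (Val≥ p (suc M)) (sym (block-split q))
      (Val≥-+ pp (lower-Val≥ q) (subst (λ z → Val≥ p (suc M) (c′ * z - c * σ q)) (sym (σ-last q)) (lastInBlock-Val≥ M q q<N))))
    where
    open ≡-Reasoning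
    open ℚSolver.+-*-Solver
    N = p ^ M
    c′ = fromℕ (p ^ suc M) * inv (2 ^ (p ℕ.* N))
    c = fromℕ N * inv (2 ^ N)
    block : ℕ → ℕ → ℚ
    block q m = ∑ m (λ r → σ (p ℕ.* q ℕ.+ r))
    F-F≡∑ : F (p ^ suc M) - F N ≡ ∑ N (λ q → c′ * block q p - c * σ q)
    F-F≡∑ = begin
      c′ * S (p ℕ.* N) - c * S N                       ≡⟨ cong (λ z → c′ * z - c * S N) (∑-*ₙ p N σ) ⟩
      c′ * ∑ N (λ q → block q p) - c * S N             ≡⟨ cong₂ _-_ (∑-*ˡ N c′ (λ q → block q p)) (∑-*ˡ N c σ) ⟩
      ∑ N (λ q → c′ * block q p) - ∑ N (λ q → c * σ q) ≡⟨ sym (∑-- N (λ q → c′ * block q p) (λ q → c * σ q)) ⟩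
      ∑ N (λ q → c′ * block q p - c * σ q)             ∎
    block-split : ∀ q → c′ * block q p - c * σ q ≡ c′ * block q (p ∸ 1) + (c′ * σ (p ℕ.* q ℕ.+ (p ∸ 1)) - c * σ q)
    block-split q = trans (cong (λ m → c′ * block q m - c * σ q) (sym 1+[p∸1]≡p))
      (solve 4 (λ c′ X Y Z → c′ :* (X :+ Y) :- Z := c′ :* X :+ (c′ :* Y :- Z)) refl c′ (block q (p ∸ 1)) (σ (p ℕ.* q ℕ.+ (p ∸ 1))) (c * σ q))
    σ-last : ∀ q → σ (p ℕ.* q ℕ.+ (p ∸ 1)) ≡ fromℕ (2 ^ (p ℕ.* suc q)) * inv (p ℕ.* suc q)
    σ-last q = cong (λ m → fromℕ (2 ^ m) * inv m) (begin
      suc (p ℕ.* q ℕ.+ (p ∸ 1)) ≡⟨ sym (ℕP.+-suc (p ℕ.* q) (p ∸ 1)) ⟩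
      p ℕ.* q ℕ.+ suc (p ∸ 1)   ≡⟨ cong (p ℕ.* q ℕ.+_) 1+[p∸1]≡p ⟩
      p ℕ.* q ℕ.+ p             ≡⟨ ℕP.+-comm (p ℕ.* q) p ⟩
      p ℕ.+ p ℕ.* q             ≡⟨ sym (ℕP.*-suc p q) ⟩
      p ℕ.* suc q               ∎)
    p∤ : ∀ q r → r < p ∸ 1 → ¬ p ∣ suc (p ℕ.* q ℕ.+ r)
    p∤ q r r<p∸1 p∣ = ℕP.<⇒≱ (subst (suc r <_) 1+[p∸1]≡p (s≤s r<p∸1))
      (∣.∣⇒≤ (∣.∣m+n∣m⇒∣n (subst (p ∣_) (sym (ℕP.+-suc (p ℕ.* q) r)) p∣) (∣.m∣m*n q)))
    lower-Val≥ : ∀ q → Val≥ p (suc M) (c′ * block q (p ∸ 1))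
    lower-Val≥ q = subst (Val≥ p (suc M)) (sym (∑-*ˡ (p ∸ 1) c′ _)) (Val≥-∑ pp (p ∸ 1) _ λ r r<p∸1 →
      Val≥-*-unit pp (Val≥-*-unit pp (Val≥-p^ pp (suc M)) (Val≥-inv pp (p∤2^ (p ℕ.* N))))
        (Val≥-*-unit pp (Val≥-fromℕ pp _) (Val≥-inv pp (p∤ q r r<p∸1))))

module _ {p : ℕ} (pp : Prime p) (a : ℕ → ℚ) where

  Val≥-successive⇒PCauchy : (∀ m → Val≥ p m (a (suc m) - a m)) → PCauchy p a
  Val≥-successive⇒PCauchy step k = k , λ m n m≥k n≥k → Val≥⇒ValGe pp
    (subst (Val≥ p k) (solve 3 (λ x y z → (x :- z) :- (y :- z) := x :- y) refl (a m) (a n) (a k))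
      (Val≥-- pp (from-k m m≥k) (from-k n n≥k)))
    where
    open ℚSolver.+-*-Solver
    telescope : ∀ K n → Val≥ p K (a (K ℕ.+ n) - a K)
    telescope K zero = subst (λ i → Val≥ p K (a i - a K)) (sym (ℕP.+-identityʳ K))
      (subst (Val≥ p K) (sym (ℚP.+-inverseʳ (a K))) (Val≥-0 pp K))
    telescope K (suc n) = subst (λ i → Val≥ p K (a i - a K)) (sym (ℕP.+-suc K n))
      (subst (Val≥ p K) (solve 3 (λ x y z → (x :- y) :+ (y :- z) := x :- z) refl (a (suc (K ℕ.+ n))) (a (K ℕ.+ n)) (a K))
        (Val≥-+ pp (Val≥-weaken pp (ℕP.m≤m+n K n) (step (K ℕ.+ n))) (telescope K n)))
    from-k : ∀ m → m ≥ k → Val≥ p k (a m - a k)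
    from-k m m≥k = subst (λ i → Val≥ p k (a i - a k)) (ℕP.m+[n∸m]≡n m≥k) (telescope k (m ∸ k))

  Val≥⇒PConvergesTo0 : (∀ n → Val≥ p n (a n)) → PConvergesTo p a 0ℚ
  Val≥⇒PConvergesTo0 an k = k , λ n n≥k → Val≥⇒ValGe pp
    (subst (Val≥ p k) (sym (ℚP.+-identityʳ (a n))) (Val≥-weaken pp n≥k (an n)))

fSeqAtMinusOne≡F : ∀ p .{{_ : NonZero p}} m → fSeqAtMinusOne p m ≡ F (p ^ suc m)
fSeqAtMinusOne≡F p m = trans (f≡F (p ^ suc m ∸ 1))
  (cong F (trans (ℕP.+-comm 1 _) (ℕP.m∸n+n≡m {p ^ suc m} {1} (ℕP.m^n>0 p (suc m)))))

fSeqAtMinusOne2-Val≥ : ∀ m → Val≥ 2 m (fSeqAtMinusOne 2 m)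
fSeqAtMinusOne2-Val≥ m = subst (Val≥ 2 m) (sym (fSeqAtMinusOne≡F 2 m)) (Val≥-weaken prime[2] (ℕP.n≤1+n m) (F-2^-Val≥ (suc m)))

PConvergesTo-2 : PConvergesTo 2 (fSeqAtMinusOne 2) 0ℚ
PConvergesTo-2 = Val≥⇒PConvergesTo0 prime[2] (fSeqAtMinusOne 2) fSeqAtMinusOne2-Val≥

PCauchy-2 : PCauchy 2 (fSeqAtMinusOne 2)
PCauchy-2 = Val≥-successive⇒PCauchy prime[2] (fSeqAtMinusOne 2) λ m →
  Val≥-- prime[2] (Val≥-weaken prime[2] (ℕP.n≤1+n m) (fSeqAtMinusOne2-Val≥ (suc m))) (fSeqAtMinusOne2-Val≥ m)

module _ {p : ℕ} (pp : Prime p) (p≢2 : p ≢ 2) where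

  private instance
    p≢0 : NonZero p
    p≢0 = prime⇒nonZero pp

  PCauchy-odd : PCauchy p (fSeqAtMinusOne p)
  PCauchy-odd = Val≥-successive⇒PCauchy pp (fSeqAtMinusOne p) λ m →
    subst (Val≥ p m) (sym (cong₂ _-_ (fSeqAtMinusOne≡F p (suc m)) (fSeqAtMinusOne≡F p m)))
      (Val≥-weaken pp (ℕP.≤-trans (ℕP.n≤1+n m) (ℕP.n≤1+n (suc m))) (F-p^-difference-Val≥ pp p≢2 (suc m)))

  LimitIn1+pZp-odd : LimitIn1+pZp p (fSeqAtMinusOne p)
  LimitIn1+pZp-odd = 0 , λ n _ → Val≥⇒ValGe pp
    (subst (λ x → Val≥ p 1 (x - 1ℚ)) (sym (fSeqAtMinusOne≡F p n)) (F-p^-1-Val≥ pp p≢2 (suc n)))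

theorem1p6 : (p : ℕ) → Prime p →
    PCauchy p (fSeqAtMinusOne p)
    × (p ≡ 2 → PConvergesTo p (fSeqAtMinusOne p) 0ℚ)
    × (p ≢ 2 → LimitIn1+pZp p (fSeqAtMinusOne p))
theorem1p6 p pp with p ≟ 2
... | yes refl = PCauchy-2 , (λ _ → PConvergesTo-2) , (λ p≢2 → ⊥-elim (p≢2 refl))
... | no p≢2 = PCauchy-odd pp p≢2 , (λ p≡2 → ⊥-elim (p≢2 p≡2)) , (λ _ → LimitIn1+pZp-odd pp p≢2)
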